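{- (a) For every isotropic root $\alpha$, the rule $[\lambda,j]\mapsto[t_{\nu^j\alpha}(\lambda),j]$ (for $(\lambda,j)\in X\times\mathbb Z$ with $\lambda\in X_{\nu^j\alpha}$) is a well-defined bijection from $Y_\alpha=\{[\lambda,j]:\lambda\in X_{\nu^j\alpha}\}$ onto $Y_{ -\alpha}$, and the bijections for $\alpha$ and $-\alpha$ are mutually inverse; this defines an action of the groupoid $\mathfrak T_{iso}$ on $(X\times\mathbb Z)/\!\sim$ (a functor $F$ with $F(\alpha)=Y_\alpha$). (b) Likewise, the rule $[\mathfrak b,j]\mapsto[r_{\nu^j\alpha}(\mathfrak b),j]$ (for $\mathfrak b\in\mathcal B^\circ$ having $\nu^j\alpha$ as a simple root) is a well-defined bijection from $Z_\alpha=\{[\mathfrak b,j]:\nu^j\alpha \text{ is a simple root of }\mathfrak b\}$ onto $Z_{ -\alpha}$, these bijections for $\pm\alpha$ being mutually inverse, giving an action $B$ of $\mathfrak T_{iso}$ on $(\mathcal B^\circ\times\mathbb Z)/\!\sim$. (c) The map $[\zeta(\sigma),k]\mapsto[\mathfrak b(\sigma),k]$ is a well-defined bijection $(X\times\mathbb Z)/\!\sim\;\to(\mathcal B^\circ\times\mathbb Z)/\!\sim$ carrying $Y_\alpha$ onto $Z_\alpha$ and intertwining the actions $F$ and $B$.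
   Context: Fix positive integers $m>n$. $\mathbf R$: grid with rows $\epsilon_1,\dots,\epsilon_n$ (top to bottom), columns $\delta_1,\dots,\delta_m$; $X$: partitions $\lambda=(\lambda_1\ge\dots\ge\lambda_n\ge0)$ with $\lambda_1\le m$, drawn with $\lambda_k$ left-justified boxes in row $\epsilon_{n+1-k}$. Isotropic roots are $\pm(\epsilon_i-\delta_j)$; $\nu(\pm(\epsilon_i-\delta_j))=\pm(\epsilon_{i+1}-\delta_j)$, indices mod $n$ in $\{1,\dots,n\}$. For $\alpha=\epsilon_i-\delta_j$: $X_\alpha$ (resp. $X_{ -\alpha}$) is the set of $\lambda$ for which box $\epsilon_i-\delta_j$ is an outer corner (resp. inner corner); $t_\alpha$ adds and $t_{ -\alpha}$ removes that box. For $\lambda_1=m$, $\overline\lambda=(\lambda_2,\dots,\lambda_n,0)$; $\sim$ is the smallest equivalence relation on $X\times\mathbb Z$ with $(\lambda,k)\sim(\overline\lambda,k+1)$ when $\lambda_1=m$; $[\lambda,k]$ denotes the class. Shuffles: permutations $\sigma$ of $\{1,\dots,n,1',\dots,m'\}$ with one-line notation $(\sigma(1),\dots,\sigma(n),\sigma(1'),\dots,\sigma(m'))$ containing $1,\dots,n$ and $1',\dots,m'$ each in order. $\zeta(\sigma)\in X$: the boxes below the lattice path from top-left to bottom-right of $\mathbf R$ whose $k$-th step is down iff the $k$-th entry is unprimed ($\zeta$ is a bijection). With $\epsilon_{j'}=\delta_j$, $\mathfrak b(\sigma)$ is the Borel subalgebra of $\mathfrak{gl}(n|m)$ containing the diagonal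 matrices with simple roots $\epsilon_{e_k}-\epsilon_{e_{k+1}}$ ($e_k$ the $k$-th one-line entry); $\mathcal B^\circ=\{\mathfrak b(\sigma)\}$. Odd reflection: for a simple isotropic root $\gamma$ of $\mathfrak b$ with simple roots $\Pi$, $r_\gamma(\mathfrak b)$ has simple roots $r_\gamma(\beta)$, $\beta\in\Pi$, where $r_\gamma(\gamma)=-\gamma$, $r_\gamma(\beta)=\beta+\gamma$ if that is a root, else $\beta$. If $\sigma(m')=n$, $\overline\sigma$ is the shuffle with one-line notation $(1,\nu^{ -1}e_1,\dots,\nu^{ -1}e_{m+n-1})$ where $\nu^{ -1}$ fixes primed entries and sends $k\mapsto k+1$ ($k<n$), $n\mapsto1$. $\sim$ on $\mathcal B^\circ\times\mathbb Z$ is the smallest equivalence relation with $(\mathfrak b(\sigma),k)\sim(\mathfrak b(\overline\sigma),k+1)$ when $\sigma(m')=n$. -}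

module Defs where

open import Data.Nat as ℕ using (ℕ; zero; suc; _≤_; _<_)
open import Data.Nat.DivMod using (_%_; m%n<n)
open import Data.Integer as ℤ using (ℤ; +_; -[1+_])
import Data.Integer.Properties as ℤP
open import Data.Fin as Fin using (Fin; toℕ; fromℕ; fromℕ<; opposite; _↑ˡ_; _↑ʳ_)
import Data.Fin.Properties as FinP
open import Data.Vec as Vec using (Vec; []; _∷_; _∷ʳ_; lookup; updateAt; tabulate)
import Data.Vec.Properties as VecP
open import Data.List as List using (List; []; _∷_; mapMaybe; allFin; zipWith; drop)
open import Data.List.Membership.Propositional using (_∈_)
open import Data.Maybe using (Maybe; just; nothing)
open import Data.Product using (Σ; ∃; _×_; _,_)
open import Relation.Nullary using (does; ¬?)
open import Relation.Nullary.Decidable using (_×-dec_)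
open import Relation.Binary using (Rel)
open import Relation.Binary.PropositionalEquality using (_≡_)
open import Relation.Binary.Construct.Closure.Equivalence using (EqClosure)
open import Function.Bundles using (_⇔_)
open import Data.Bool using (if_then_else_)

-- Cyclic shift on row indices (0-based Fin n; paper's index i is toℕ i + 1)

cyc : ∀ {n} → Fin n → Fin n
cyc {suc n} i = fromℕ< (m%n<n (suc (toℕ i)) (suc n))

-- i ↦ i-1 (mod n)
cyc⁻¹ : ∀ {n} → Fin n → Fin n
cyc⁻¹ {suc n} i = fromℕ< (m%n<n (toℕ i ℕ.+ n) (suc n))

iter : ∀ {A : Set} → ℕ → (A → A) → A → A
iter zero    f x = x
iter (suc k) f x = f (iter k f x)

-- Isotropic roots  ±(ε_i - δ_j)

data IsoRoot (n m : ℕ) : Set where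
  pos : Fin n → Fin m → IsoRoot n m   --  ε_i - δ_j
  neg : Fin n → Fin m → IsoRoot n m   -- -(ε_i - δ_j)

-_ᴵ : ∀ {n m} → IsoRoot n m → IsoRoot n m
-(pos i j) ᴵ = neg i j
-(neg i j) ᴵ = pos i j

ν : ∀ {n m} → IsoRoot n m → IsoRoot n m
ν (pos i j) = pos (cyc i) j
ν (neg i j) = neg (cyc i) j

ν⁻¹ : ∀ {n m} → IsoRoot n m → IsoRoot n m
ν⁻¹ (pos i j) = pos (cyc⁻¹ i) j
ν⁻¹ (neg i j) = neg (cyc⁻¹ i) j

ν^ : ∀ {n m} → ℤ → IsoRoot n m → IsoRoot n m
ν^ (+ k)      = iter k ν
ν^ (-[1+ k ]) = iter (suc k) ν⁻¹

-- X : partitions λ = (λ_1 ≥ … ≥ λ_n ≥ 0), λ_1 ≤ m, as Vec ℕ n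
-- (position k of the vector, 0-based, holds λ_{k+1}).
-- Row ε_i (0-based i) holds λ_{n-i}, i.e. vector position  opposite i.

IsX : ∀ {n} (m : ℕ) → Vec ℕ n → Set
IsX {n} m lam =
  ((k : Fin n) → lookup lam k ≤ m) ×
  ((k l : Fin n) → k Fin.≤ l → lookup lam l ≤ lookup lam k)

addBox : ∀ {n} → Fin n → Vec ℕ n → Vec ℕ n
addBox i lam = updateAt lam (opposite i) suc

removeBox : ∀ {n} → Fin n → Vec ℕ n → Vec ℕ n
removeBox i lam = updateAt lam (opposite i) ℕ.pred

-- box ε_i - δ_j (row i, column j, 0-based) is an outer corner of λ:
-- the box is not in λ, it is the next box of its row, and λ ∪ {box} ∈ X
OuterCorner : ∀ {n} (m : ℕ) → Fin n → Fin m → Vec ℕ n → Set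
OuterCorner m i j lam = (lookup lam (opposite i) ≡ toℕ j) × IsX m (addBox i lam)

-- box ε_i - δ_j is an inner corner of λ:
-- the box is the last box of its row and λ ∖ {box} ∈ X
InnerCorner : ∀ {n} (m : ℕ) → Fin n → Fin m → Vec ℕ n → Set
InnerCorner m i j lam = (lookup lam (opposite i) ≡ suc (toℕ j)) × IsX m (removeBox i lam)

X_ : ∀ {n m} → IsoRoot n m → Vec ℕ n → Set
X_ {m = m} (pos i j) lam = OuterCorner m i j lam
X_ {m = m} (neg i j) lam = InnerCorner m i j lam

t_ : ∀ {n m} → IsoRoot n m → Vec ℕ n → Vec ℕ n
t_ (pos i j) = addBox i
t_ (neg i j) = removeBox i

-- the relation generating ∼ on X × ℤ : (λ,k) ∼ (λ̄,k+1) when λ_1 = m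
data XStep (m : ℕ) : (n : ℕ) → Rel (Vec ℕ n × ℤ) Agda.Primitive.lzero where
  xstep : ∀ {n} (xs : Vec ℕ n) (k : ℤ) → IsX m (m ∷ xs) →
          XStep m (suc n) (m ∷ xs , k) (xs ∷ʳ 0 , k ℤ.+ ℤ.1ℤ)

_∼X[_]_ : ∀ {n} → Vec ℕ n × ℤ → ℕ → Vec ℕ n × ℤ → Set
_∼X[_]_ {n} x m y = EqClosure (XStep m n) x y

-- Shuffles, given by their one-line notation (σ(1),…,σ(n),σ(1'),…,σ(m'))

data Label (n m : ℕ) : Set where
  unp : Fin n → Label n m
  pr  : Fin m → Label n m

unprimed : ∀ {n m} → List (Label n m) → List (Fin n)
unprimed = mapMaybe (λ { (unp i) → just i ; (pr _) → nothing })

primed : ∀ {n m} → List (Label n m) → List (Fin m)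
primed = mapMaybe (λ { (unp _) → nothing ; (pr j) → just j })

-- a word is (the one-line notation of) a shuffle: it contains 1,…,n and
-- 1',…,m' each exactly once and in order
IsShuffle : ∀ {n m} → List (Label n m) → Set
IsShuffle {n} {m} w = (unprimed w ≡ allFin n) × (primed w ≡ allFin m)

-- ν⁻¹ on one-line entries: fixes primed, k ↦ k+1 (k<n), n ↦ 1
ν⁻¹L : ∀ {n m} → Label n m → Label n m
ν⁻¹L (unp i) = unp (cyc i)
ν⁻¹L (pr j)  = pr j

-- ζ(σ): row ε_i has as many boxes as there are primed entries (right steps)
-- before the entry i (the i-th down step) in the one-line notation.
primedBefore : ∀ {n m} → Fin n → List (Label n m) → ℕ
primedBefore i []            = 0
primedBefore i (unp i' ∷ w)  = if does (i FinP.≟ i') then 0 else primedBefore i w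
primedBefore i (pr _ ∷ w)    = suc (primedBefore i w)

ζ : ∀ {n m} → List (Label n m) → Vec ℕ n
ζ w = tabulate (λ k → primedBefore (opposite k) w)

-- Weights of gl(n|m): integer vectors in the basis ε_1,…,ε_n,δ_1,…,δ_m
-- (δ_j = ε_{j'}).  Roots are ε_a - ε_b with a ≠ b.

record Weight (n m : ℕ) : Set where
  constructor ⟨_⟩
  field vec : Vec ℤ (n ℕ.+ m)
open Weight public

idx : ∀ {n m} → Label n m → Fin (n ℕ.+ m)
idx {n} {m} (unp i) = i ↑ˡ m
idx {n} {m} (pr j)  = n ↑ʳ j

εv : ∀ {N} → Fin N → Vec ℤ N
εv a = tabulate (λ x → if does (x FinP.≟ a) then ℤ.1ℤ else ℤ.0ℤ)

_⊕_ : ∀ {N} → Vec ℤ N → Vec ℤ N → Vec ℤ N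
_⊕_ = Vec.zipWith ℤ._+_

⊖_ : ∀ {N} → Vec ℤ N → Vec ℤ N
⊖_ = Vec.map (λ x → ℤ.- x)

rootV : ∀ {N} → Fin N → Fin N → Vec ℤ N
rootV a b = εv a ⊕ (⊖ εv b)

IsRoot : ∀ {N} → Vec ℤ N → Set
IsRoot w = ∃ λ a → ∃ λ b → (¬ (a ≡ b)) × (w ≡ rootV a b)
  where open import Relation.Nullary using (¬_)

isRoot? : ∀ {N} (w : Vec ℤ N) → Relation.Nullary.Dec (IsRoot w)
isRoot? w = FinP.any? (λ a → FinP.any? (λ b → ¬? (a FinP.≟ b) ×-dec VecP.≡-dec ℤ._≟_ w (rootV a b)))

wt : ∀ {n m} → IsoRoot n m → Weight n m
wt (pos i j) = ⟨ rootV (idx (unp i)) (idx (pr j)) ⟩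
wt (neg i j) = ⟨ rootV (idx (pr j)) (idx (unp i)) ⟩

-- Borel subalgebras containing the diagonal, represented by their list of
-- simple roots in Dynkin-chain order.

Borel : ℕ → ℕ → Set
Borel n m = List (Weight n m)

𝔟 : ∀ {n m} → List (Label n m) → Borel n m
𝔟 w = zipWith (λ a b → ⟨ rootV a b ⟩) (List.map idx w) (drop 1 (List.map idx w))

InB° : ∀ {n m} → Borel n m → Set
InB° {n} {m} b = Σ (List (Label n m)) λ w → IsShuffle w × (𝔟 w ≡ b)

rβ : ∀ {n m} → Weight n m → Weight n m → Weight n m
rβ ⟨ γ ⟩ ⟨ β ⟩ = if does (VecP.≡-dec ℤ._≟_ β γ) then ⟨ ⊖ γ ⟩
         else (if does (isRoot? (β ⊕ γ)) then ⟨ β ⊕ γ ⟩ else ⟨ β ⟩)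

r_ : ∀ {n m} → Weight n m → Borel n m → Borel n m
r_ γ = List.map (rβ γ)

-- the relation generating ∼ on ℬ° × ℤ : (𝔟(σ),k) ∼ (𝔟(σ̄),k+1) when σ(m') = n
-- (σ(m') is the last one-line entry; σ̄ = (1, ν⁻¹e_1, …, ν⁻¹e_{m+n-1}))
data BStep (m : ℕ) : (n : ℕ) → Rel (Borel n m × ℤ) Agda.Primitive.lzero where
  bstep : ∀ {n} (w : List (Label (suc n) m)) (k : ℤ) →
          IsShuffle (w List.∷ʳ unp (fromℕ n)) →
          BStep m (suc n) (𝔟 (w List.∷ʳ unp (fromℕ n)) , k)
                          (𝔟 (unp Fin.zero ∷ List.map ν⁻¹L w) , k ℤ.+ ℤ.1ℤ)

_∼B_ : ∀ {n m} → Rel (Borel n m × ℤ) Agda.Primitive.lzero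
_∼B_ {n} {m} = EqClosure (BStep m n)

-- Y_α and Z_α as sets of classes: a class belongs to it iff some
-- representative satisfies the defining condition.

InY : ∀ {n m} → IsoRoot n m → Vec ℕ n × ℤ → Set
InY {n} {m} α c = Σ (Vec ℕ n) λ lam → Σ ℤ λ j →
  IsX m lam × X_ (ν^ j α) lam × ((lam , j) ∼X[ m ] c)

InZ : ∀ {n m} → IsoRoot n m → Borel n m × ℤ → Set
InZ {n} {m} α c = Σ (Borel n m) λ b → Σ ℤ λ j →
  InB° b × (wt (ν^ j α) ∈ b) × ((b , j) ∼B c)

PartA : (n m : ℕ) → IsoRoot n m → Set
PartA n m α =
  ((lam : Vec ℕ n) (j : ℤ) → IsX m lam → X_ (ν^ j α) lam →
     IsX m (t_ (ν^ j α) lam) × X_ (ν^ j (-(α) ᴵ)) (t_ (ν^ j α) lam)) ×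
  ((lam lam' : Vec ℕ n) (j j' : ℤ) → IsX m lam → IsX m lam' →
     X_ (ν^ j α) lam → X_ (ν^ j' α) lam' → (lam , j) ∼X[ m ] (lam' , j') →
     (t_ (ν^ j α) lam , j) ∼X[ m ] (t_ (ν^ j' α) lam' , j')) ×
  ((lam : Vec ℕ n) (j : ℤ) → IsX m lam → X_ (ν^ j α) lam →
     (t_ (ν^ j (-(α) ᴵ)) (t_ (ν^ j α) lam) , j) ∼X[ m ] (lam , j))

PartB : (n m : ℕ) → IsoRoot n m → Set
PartB n m α =
  ((b : Borel n m) (j : ℤ) → InB° b → wt (ν^ j α) ∈ b →
     InB° (r_ (wt (ν^ j α)) b) × (wt (ν^ j (-(α) ᴵ)) ∈ r_ (wt (ν^ j α)) b)) ×
  ((b b' : Borel n m) (j j' : ℤ) → InB° b → InB° b' →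
     wt (ν^ j α) ∈ b → wt (ν^ j' α) ∈ b' → (b , j) ∼B (b' , j') →
     (r_ (wt (ν^ j α)) b , j) ∼B (r_ (wt (ν^ j' α)) b' , j')) ×
  ((b : Borel n m) (j : ℤ) → InB° b → wt (ν^ j α) ∈ b →
     (r_ (wt (ν^ j (-(α) ᴵ))) (r_ (wt (ν^ j α)) b) , j) ∼B (b , j))

PartC : (n m : ℕ) → Set
PartC n m =
  ((lam : Vec ℕ n) → IsX m lam →
     Σ (List (Label n m)) λ w → IsShuffle w × (ζ w ≡ lam)) ×
  ((w w' : List (Label n m)) (k k' : ℤ) → IsShuffle w → IsShuffle w' →
     (ζ w , k) ∼X[ m ] (ζ w' , k') → (𝔟 w , k) ∼B (𝔟 w' , k')) ×
  ((w w' : List (Label n m)) (k k' : ℤ) → IsShuffle w → IsShuffle w' →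
     (𝔟 w , k) ∼B (𝔟 w' , k') → (ζ w , k) ∼X[ m ] (ζ w' , k')) ×
  ((b : Borel n m) (k : ℤ) → InB° b →
     Σ (List (Label n m)) λ w → IsShuffle w × ((𝔟 w , k) ∼B (b , k))) ×
  ((α : IsoRoot n m) (w : List (Label n m)) (k : ℤ) → IsShuffle w →
     InY α (ζ w , k) ⇔ InZ α (𝔟 w , k)) ×
  -- intertwines: Φ(F_α[ζ(σ),j]) = B_α(Φ[ζ(σ),j])
  ((α : IsoRoot n m) (w w' : List (Label n m)) (j : ℤ) →
     IsShuffle w → IsShuffle w' → X_ (ν^ j α) (ζ w) →
     ζ w' ≡ t_ (ν^ j α) (ζ w) →
     Σ (Borel n m) λ b → Σ ℤ λ j' →
       InB° b × (wt (ν^ j' α) ∈ b) × ((b , j') ∼B (𝔟 w , j)) ×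
       ((r_ (wt (ν^ j' α)) b , j') ∼B (𝔟 w' , j)))

-- A shuffle σ is the lattice path of ζ(σ), so ζ is a bijection from shuffles
-- onto X, and 𝔟 is injective on shuffles. The root β = ±(ε_i − δ_j) is a
-- corner of ζ(σ) in X_β, and a simple root of 𝔟(σ), exactly when the two
-- letters of β are adjacent in σ in the right order; t_β and the odd
-- reflection r_β then both swap these letters. Both relations ∼ are images of
-- the relation generated on shuffles by (σ, k) ↦ (σ̄, k + 1). That step is
-- functional and injective, so related pairs lie on one chain of steps, and
-- swapping the letters of ν^k α commutes with every step of it. This gives
-- well-definedness of both actions and, transported through σ, part (c).

module Submission where

open import Defs
open import Data.Nat as ℕ using (ℕ; zero; suc; _≤_; _<_; z≤n; s≤s; NonZero)
import Data.Nat.Properties as ℕP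
import Data.Integer.Properties as ℤP
open import Data.Nat.DivMod using (_%_; %-distribˡ-+; m%n%n≡m%n; [m+n]%n≡m%n; m<n⇒m%n≡m; n%n≡0; m%n<n)
open import Data.Integer as ℤ using (ℤ; +_; -[1+_])
open import Data.Integer.Tactic.RingSolver using (solve-∀)
open import Data.Fin as Fin using (Fin; toℕ; fromℕ; inject₁; opposite)
import Data.Fin.Properties as FinP
open import Data.Vec as Vec using (Vec; lookup; tabulate)
import Data.Vec.Properties as VecP
open import Data.List as List using (List; []; _∷_; _++_; _∷ʳ_; _∷ʳ′_; length; allFin)
import Data.List.Properties as ListP
open import Data.List.Membership.Propositional using (_∈_; _∉_)
open import Data.List.Membership.Propositional.Properties using (∈-++⁺ʳ; ∈-allFin; ∈-map⁺; ∈-map⁻)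
open import Data.List.Relation.Unary.Any using (here; there)
open import Data.List.Relation.Unary.All as All using (All; []; _∷_)
open import Data.List.Relation.Unary.AllPairs as AllPairs using (AllPairs; []; _∷_)
open import Data.List.Relation.Unary.Unique.Propositional using (Unique)
import Data.List.Relation.Unary.Unique.Propositional.Properties as UniqueP
open import Data.Product using (Σ; _×_; _,_; proj₁; proj₂)
open import Data.Product.Properties using (,-injective; ,-injectiveˡ)
open import Data.Sum using (_⊎_; inj₁; inj₂)
open import Data.Empty using (⊥; ⊥-elim)
open import Data.Bool using (if_then_else_)
open import Function using (_∘_; id; flip)
open import Relation.Nullary using (¬_; yes; no; does)
open import Relation.Nullary.Decidable using (dec-true; dec-false)
open import Level using (0ℓ)
open import Relation.Binary using (Rel)
open import Function.Bundles using (mk⇔)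
open import Relation.Binary.PropositionalEquality
open import Relation.Binary.Construct.Closure.ReflexiveTransitive as Star using (Star; ε; _◅_)
open import Relation.Binary.Construct.Closure.Symmetric using (fwd; bwd)
open import Relation.Binary.Construct.Closure.Equivalence as Equivalence using (EqClosure; symmetric)

-- Equivalence closures

module Chain {A : Set} (S : Rel A 0ℓ)
  (functional : ∀ {x y x' y'} → S x y → S x' y' → x ≡ x' → y ≡ y')
  (injective  : ∀ {x y x' y'} → S x y → S x' y' → y ≡ y' → x ≡ x')
  where

  private
    straighten′ : ∀ {x y} → EqClosure S x y → Star S x y ⊎ Star (flip S) x y
    straighten′ ε = inj₁ ε
    straighten′ (fwd s ◅ e) with straighten′ e
    ... | inj₁ p        = inj₁ (s ◅ p)
    ... | inj₂ ε        = inj₁ (s ◅ ε)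
    ... | inj₂ (s' ◅ p) with refl ← injective s' s refl = inj₂ p
    straighten′ (bwd s ◅ e) with straighten′ e
    ... | inj₂ p        = inj₂ (s ◅ p)
    ... | inj₁ ε        = inj₂ (s ◅ ε)
    ... | inj₁ (s' ◅ p) with refl ← functional s s' refl = inj₁ p

  straighten : ∀ {x y} → EqClosure S x y → Star S x y ⊎ Star S y x
  straighten e with straighten′ e
  ... | inj₁ p = inj₁ p
  ... | inj₂ p = inj₂ (Star.reverse id p)

  -- P is only needed at the interior points of a chain; the equation z ≡ z'
  -- lets instances match on both steps.
  module Transport (P : A → Set) (T : ∀ x → P x → A)
    (irrelevant : ∀ {x} (p p' : P x) → T x p ≡ T x p')
    (propagate  : ∀ {x z z' u} → P x → S x z → S z' u → z ≡ z' → P z)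
    (commute    : ∀ {x z} (px : P x) (pz : P z) → S x z → S (T x px) (T z pz))
    where

    transport-Star : ∀ {x y} (px : P x) (py : P y) → Star S x y → Star S (T x px) (T y py)
    transport-Star px py ε            = subst (Star S _) (irrelevant px py) ε
    transport-Star px py (s ◅ ε)      = commute px py s ◅ ε
    transport-Star px py (s ◅ s' ◅ p) = commute px pz s ◅ transport-Star pz py (s' ◅ p)
      where pz = propagate px s s' refl

    transport : ∀ {x y} (px : P x) (py : P y) → EqClosure S x y → EqClosure S (T x px) (T y py)
    transport px py e with straighten e
    ... | inj₁ p = Star.map fwd (transport-Star px py p)
    ... | inj₂ p = symmetric S (Star.map fwd (transport-Star py px p))

module Lift {A B : Set} (h : A → B) (Good : A → Set) (R : Rel A 0ℓ) (S : Rel B 0ℓ)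
  (injective : ∀ {a a'} → Good a → Good a' → h a ≡ h a' → a ≡ a')
  (lift-fwd  : ∀ {b b' a} → S b b' → Good a → h a ≡ b → Σ A λ a' → Good a' × R a a' × h a' ≡ b')
  (lift-bwd  : ∀ {b b' a} → S b b' → Good a → h a ≡ b' → Σ A λ a' → Good a' × R a' a × h a' ≡ b)
  where

  private
    lift′ : ∀ {b b'} → EqClosure S b b' → ∀ {a} → Good a → h a ≡ b →
            Σ A λ a' → Good a' × h a' ≡ b' × EqClosure R a a'
    lift′ ε           ga refl = _ , ga , refl , ε
    lift′ (fwd s ◅ e) ga ha≡
      with a' , ga' , r , ha'≡ ← lift-fwd s ga ha≡
      with a'' , ga'' , ha''≡ , e' ← lift′ e ga' ha'≡ = a'' , ga'' , ha''≡ , fwd r ◅ e'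
    lift′ (bwd s ◅ e) ga ha≡
      with a' , ga' , r , ha'≡ ← lift-bwd s ga ha≡
      with a'' , ga'' , ha''≡ , e' ← lift′ e ga' ha'≡ = a'' , ga'' , ha''≡ , bwd r ◅ e'

  lift : ∀ {a a'} → Good a → Good a' → EqClosure S (h a) (h a') → EqClosure R a a'
  lift ga ga' e with a'' , ga'' , ha''≡ , e' ← lift′ e ga refl with refl ← injective ga'' ga' ha''≡ = e'

Unique[xs++y∷ys]⇒y∉xs : ∀ {A : Set} (xs : List A) {y : A} {ys} → Unique (xs ++ y ∷ ys) → y ∉ xs
Unique[xs++y∷ys]⇒y∉xs (x ∷ xs) (x≢ ∷ _) (here y≡x) = All.lookup x≢ (∈-++⁺ʳ xs (here refl)) (sym y≡x)
Unique[xs++y∷ys]⇒y∉xs (x ∷ xs) (_ ∷ u)  (there y∈) = Unique[xs++y∷ys]⇒y∉xs xs u y∈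

++-∷-cancel : ∀ {A : Set} {a : A} p p' {r r'} → a ∉ p → a ∉ p' → p ++ a ∷ r ≡ p' ++ a ∷ r' → p ≡ p' × r ≡ r'
++-∷-cancel []      []       _  _   eq = refl , ListP.∷-injectiveʳ eq
++-∷-cancel []      (x ∷ p') _  a∉' eq = ⊥-elim (a∉' (here (ListP.∷-injectiveˡ eq)))
++-∷-cancel (x ∷ p) []       a∉ _   eq = ⊥-elim (a∉ (here (sym (ListP.∷-injectiveˡ eq))))
++-∷-cancel (x ∷ p) (x' ∷ p') a∉ a∉' eq with refl , eq' ← ListP.∷-injective eq =
  let p≡p' , r≡r' = ++-∷-cancel p p' (a∉ ∘ there) (a∉' ∘ there) eq' in cong (x ∷_) p≡p' , r≡r'

list-tabulate-∷ʳ : ∀ {A : Set} {n} (g : Fin (suc n) → A) →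
                   List.tabulate (g ∘ inject₁) ∷ʳ g (fromℕ n) ≡ List.tabulate g
list-tabulate-∷ʳ {n = zero}  g = refl
list-tabulate-∷ʳ {n = suc n} g = cong (g Fin.zero ∷_) (list-tabulate-∷ʳ (g ∘ Fin.suc))

vec-tabulate-∷ʳ : ∀ {A : Set} {n} (g : Fin (suc n) → A) →
                  tabulate (g ∘ inject₁) Vec.∷ʳ g (fromℕ n) ≡ tabulate g
vec-tabulate-∷ʳ {n = zero}  g = refl
vec-tabulate-∷ʳ {n = suc n} g = cong (g Fin.zero Vec.∷_) (vec-tabulate-∷ʳ (g ∘ Fin.suc))

vec-ext : ∀ {A : Set} {N} {u v : Vec A N} → (∀ z → lookup u z ≡ lookup v z) → u ≡ v
vec-ext {u = u} {v} u≗v = trans (sym (VecP.tabulate∘lookup u)) (trans (VecP.tabulate-cong u≗v) (VecP.tabulate∘lookup v))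

allFin-∷ʳ : ∀ n → allFin (suc n) ≡ List.map inject₁ (allFin n) ∷ʳ fromℕ n
allFin-∷ʳ n = sym (trans (cong (_∷ʳ fromℕ n) (ListP.map-tabulate id inject₁)) (list-tabulate-∷ʳ id))

length-allFin : ∀ n → length (allFin n) ≡ n
length-allFin n = ListP.length-tabulate id

allFin-sorted : ∀ n → AllPairs Fin._<_ (allFin n)
allFin-sorted zero    = []
allFin-sorted (suc n) =
  All.tabulate⁺ (λ _ → s≤s z≤n) ∷
  subst (AllPairs Fin._<_) (ListP.map-tabulate id Fin.suc)
    (AllPairs.map⁺ (AllPairs.map s≤s (allFin-sorted n)))
  where import Data.List.Relation.Unary.AllPairs.Properties as AllPairs
        import Data.List.Relation.Unary.All.Properties as All

tabulate-position : ∀ {N k} (f : Fin k → Fin N) a → (∀ i → toℕ (f i) ≡ a ℕ.+ toℕ i) →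
                    ∀ xs {y ys} → List.tabulate f ≡ xs ++ y ∷ ys → toℕ y ≡ a ℕ.+ length xs
tabulate-position {k = suc k} f a f≡a+ []       eq with refl ← ListP.∷-injectiveˡ eq = f≡a+ Fin.zero
tabulate-position {k = suc k} f a f≡a+ (x ∷ xs) eq = trans
  (tabulate-position (f ∘ Fin.suc) (suc a) (λ i → trans (f≡a+ (Fin.suc i)) (ℕP.+-suc a (toℕ i))) xs (ListP.∷-injectiveʳ eq))
  (sym (ℕP.+-suc a (length xs)))

allFin-position : ∀ {n} xs {y : Fin n} {ys} → allFin n ≡ xs ++ y ∷ ys → toℕ y ≡ length xs
allFin-position xs = tabulate-position id 0 (λ _ → refl) xs

opposite-fromℕ : ∀ n → opposite (fromℕ n) ≡ Fin.zero
opposite-fromℕ zero    = refl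
opposite-fromℕ (suc n) = cong inject₁ (opposite-fromℕ n)

opposite-inject₁ : ∀ {n} (i : Fin n) → opposite (inject₁ i) ≡ Fin.suc (opposite i)
opposite-inject₁ {suc n} Fin.zero    = refl
opposite-inject₁ {suc n} (Fin.suc i) = cong inject₁ (opposite-inject₁ i)

opposite-injective : ∀ {n} {k l : Fin n} → opposite k ≡ opposite l → k ≡ l
opposite-injective {k = k} {l} eq =
  trans (sym (FinP.opposite-involutive k)) (trans (cong opposite eq) (FinP.opposite-involutive l))

opposite-anti : ∀ {n} {k l : Fin n} → k Fin.≤ l → opposite l Fin.≤ opposite k
opposite-anti {n} {k} {l} k≤l =
  subst₂ ℕ._≤_ (sym (FinP.opposite-prop l)) (sym (FinP.opposite-prop k)) (ℕP.∸-monoʳ-≤ n (s≤s k≤l))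

+1-injective : ∀ {k k' : ℤ} → k ℤ.+ ℤ.1ℤ ≡ k' ℤ.+ ℤ.1ℤ → k ≡ k'
+1-injective {k} {k'} eq = trans (sym (minus-one k)) (trans (cong (ℤ._+ ℤ.-1ℤ) eq) (minus-one k'))
  where
  minus-one : ∀ x → (x ℤ.+ ℤ.1ℤ) ℤ.+ ℤ.-1ℤ ≡ x
  minus-one x = trans (ℤP.+-assoc x ℤ.1ℤ ℤ.-1ℤ) (ℤP.+-identityʳ x)

[m%d+n]%d≡[m+n]%d : ∀ m n d .{{_ : NonZero d}} → (m % d ℕ.+ n) % d ≡ (m ℕ.+ n) % d
[m%d+n]%d≡[m+n]%d m n d = begin
  (m % d ℕ.+ n) % d            ≡⟨ %-distribˡ-+ (m % d) n d ⟩
  (m % d % d ℕ.+ n % d) % d    ≡⟨ cong (λ x → (x ℕ.+ n % d) % d) (m%n%n≡m%n m d) ⟩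
  (m % d ℕ.+ n % d) % d        ≡⟨ sym (%-distribˡ-+ m n d) ⟩
  (m ℕ.+ n) % d                ∎
  where open ≡-Reasoning

cyc⁻¹-cyc : ∀ {n} (i : Fin n) → cyc⁻¹ (cyc i) ≡ i
cyc⁻¹-cyc {suc n} i = FinP.toℕ-injective (begin
  toℕ (cyc⁻¹ (cyc i))                    ≡⟨ FinP.toℕ-fromℕ< (m%n<n (toℕ (cyc i) ℕ.+ n) (suc n)) ⟩
  (toℕ (cyc i) ℕ.+ n) % suc n            ≡⟨ cong (λ x → (x ℕ.+ n) % suc n) (FinP.toℕ-fromℕ< (m%n<n (suc (toℕ i)) (suc n))) ⟩
  (suc (toℕ i) % suc n ℕ.+ n) % suc n    ≡⟨ [m%d+n]%d≡[m+n]%d (suc (toℕ i)) n (suc n) ⟩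
  (suc (toℕ i) ℕ.+ n) % suc n            ≡⟨ cong (_% suc n) (sym (ℕP.+-suc (toℕ i) n)) ⟩
  (toℕ i ℕ.+ suc n) % suc n              ≡⟨ [m+n]%n≡m%n (toℕ i) (suc n) ⟩
  toℕ i % suc n                          ≡⟨ m<n⇒m%n≡m (FinP.toℕ<n i) ⟩
  toℕ i                                  ∎)
  where open ≡-Reasoning

cyc-cyc⁻¹ : ∀ {n} (i : Fin n) → cyc (cyc⁻¹ i) ≡ i
cyc-cyc⁻¹ {suc n} i = FinP.toℕ-injective (begin
  toℕ (cyc (cyc⁻¹ i))                           ≡⟨ FinP.toℕ-fromℕ< (m%n<n (suc (toℕ (cyc⁻¹ i))) (suc n)) ⟩
  suc (toℕ (cyc⁻¹ i)) % suc n                   ≡⟨ cong (λ x → suc x % suc n) (FinP.toℕ-fromℕ< (m%n<n (toℕ i ℕ.+ n) (suc n))) ⟩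
  (1 ℕ.+ (toℕ i ℕ.+ n) % suc n) % suc n         ≡⟨ cong (_% suc n) (ℕP.+-comm 1 _) ⟩
  ((toℕ i ℕ.+ n) % suc n ℕ.+ 1) % suc n         ≡⟨ [m%d+n]%d≡[m+n]%d (toℕ i ℕ.+ n) 1 (suc n) ⟩
  (toℕ i ℕ.+ n ℕ.+ 1) % suc n                   ≡⟨ cong (_% suc n) (trans (ℕP.+-assoc (toℕ i) n 1) (cong (toℕ i ℕ.+_) (ℕP.+-comm n 1))) ⟩
  (toℕ i ℕ.+ suc n) % suc n                     ≡⟨ [m+n]%n≡m%n (toℕ i) (suc n) ⟩
  toℕ i % suc n                                 ≡⟨ m<n⇒m%n≡m (FinP.toℕ<n i) ⟩
  toℕ i                                         ∎)
  where open ≡-Reasoning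

cyc-injective : ∀ {n} {i j : Fin n} → cyc i ≡ cyc j → i ≡ j
cyc-injective {i = i} {j} eq = trans (sym (cyc⁻¹-cyc i)) (trans (cong cyc⁻¹ eq) (cyc⁻¹-cyc j))

cyc-inject₁ : ∀ {n} (i : Fin n) → cyc (inject₁ i) ≡ Fin.suc i
cyc-inject₁ {n} i = FinP.toℕ-injective (begin
  toℕ (cyc (inject₁ i))           ≡⟨ FinP.toℕ-fromℕ< _ ⟩
  suc (toℕ (inject₁ i)) % suc n   ≡⟨ cong (λ x → suc x % suc n) (FinP.toℕ-inject₁ i) ⟩
  suc (toℕ i) % suc n             ≡⟨ m<n⇒m%n≡m (s≤s (FinP.toℕ<n i)) ⟩
  suc (toℕ i)                     ∎)
  where open ≡-Reasoning

cyc-fromℕ : ∀ n → cyc (fromℕ n) ≡ Fin.zero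
cyc-fromℕ n = FinP.toℕ-injective (begin
  toℕ (cyc (fromℕ n))           ≡⟨ FinP.toℕ-fromℕ< _ ⟩
  suc (toℕ (fromℕ n)) % suc n   ≡⟨ cong (λ x → suc x % suc n) (FinP.toℕ-fromℕ n) ⟩
  suc n % suc n                 ≡⟨ n%n≡0 (suc n) ⟩
  0                             ∎)
  where open ≡-Reasoning

ν-ν⁻¹ : ∀ {n m} (β : IsoRoot n m) → ν (ν⁻¹ β) ≡ β
ν-ν⁻¹ (pos i j) = cong (λ x → pos x j) (cyc-cyc⁻¹ i)
ν-ν⁻¹ (neg i j) = cong (λ x → neg x j) (cyc-cyc⁻¹ i)

ν^-suc : ∀ {n m} (k : ℤ) (β : IsoRoot n m) → ν^ (k ℤ.+ ℤ.1ℤ) β ≡ ν (ν^ k β)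
ν^-suc (+ k)          β rewrite ℕP.+-comm k 1 = refl
ν^-suc -[1+ zero ]    β = sym (ν-ν⁻¹ β)
ν^-suc -[1+ suc k ]   β = sym (ν-ν⁻¹ _)

iter-natural : ∀ {A : Set} {f g : A → A} → (∀ x → f (g x) ≡ g (f x)) →
               ∀ k x → iter k f (g x) ≡ g (iter k f x)
iter-natural f∘g≡g∘f zero    x = refl
iter-natural {f = f} f∘g≡g∘f (suc k) x = trans (cong f (iter-natural f∘g≡g∘f k x)) (f∘g≡g∘f _)

ν^-neg : ∀ {n m} (k : ℤ) (β : IsoRoot n m) → ν^ k (- β ᴵ) ≡ - ν^ k β ᴵ
ν^-neg (+ k)    = iter-natural {f = ν} {g = -_ᴵ} (λ { (pos i j) → refl ; (neg i j) → refl }) k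
ν^-neg -[1+ k ] = iter-natural {f = ν⁻¹} {g = -_ᴵ} (λ { (pos i j) → refl ; (neg i j) → refl }) (suc k)

Word : ℕ → ℕ → Set
Word n m = List (Label n m)

unprimed-++ : ∀ {n m} (xs ys : Word n m) → unprimed (xs ++ ys) ≡ unprimed xs ++ unprimed ys
unprimed-++ = ListP.mapMaybe-++ _

primed-++ : ∀ {n m} (xs ys : Word n m) → primed (xs ++ ys) ≡ primed xs ++ primed ys
primed-++ = ListP.mapMaybe-++ _

unprimed-map-pr : ∀ {n m} (js : List (Fin m)) → unprimed {n} (List.map pr js) ≡ []
unprimed-map-pr []       = refl
unprimed-map-pr (j ∷ js) = unprimed-map-pr js

primed-map-pr : ∀ {n m} (js : List (Fin m)) → primed {n} (List.map pr js) ≡ js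
primed-map-pr []       = refl
primed-map-pr (j ∷ js) = cong (j ∷_) (primed-map-pr js)

primed-∷ʳ-unp : ∀ {n m} (p : Word n m) i → primed (p ++ unp i ∷ []) ≡ primed p
primed-∷ʳ-unp p i = trans (primed-++ p (unp i ∷ [])) (ListP.++-identityʳ _)

length-unprimed+primed : ∀ {n m} (w : Word n m) → length w ≡ length (unprimed w) ℕ.+ length (primed w)
length-unprimed+primed []          = refl
length-unprimed+primed (unp i ∷ w) = cong suc (length-unprimed+primed w)
length-unprimed+primed (pr j ∷ w)  = trans (cong suc (length-unprimed+primed w)) (sym (ℕP.+-suc _ _))

relabel : ∀ {n n' m} → (Fin n → Fin n') → Label n m → Label n' m
relabel f (unp i) = unp (f i)
relabel f (pr j)  = pr j

unprimed-relabel : ∀ {n n' m} (f : Fin n → Fin n') (w : Word n m) →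
                   unprimed (List.map (relabel f) w) ≡ List.map f (unprimed w)
unprimed-relabel f []          = refl
unprimed-relabel f (unp i ∷ w) = cong (f i ∷_) (unprimed-relabel f w)
unprimed-relabel f (pr j ∷ w)  = unprimed-relabel f w

primed-relabel : ∀ {n n' m} (f : Fin n → Fin n') (w : Word n m) →
                 primed (List.map (relabel f) w) ≡ primed w
primed-relabel f []          = refl
primed-relabel f (unp i ∷ w) = primed-relabel f w
primed-relabel f (pr j ∷ w)  = cong (j ∷_) (primed-relabel f w)

map-ν⁻¹L : ∀ {n m} (w : Word n m) → List.map ν⁻¹L w ≡ List.map (relabel cyc) w
map-ν⁻¹L = ListP.map-cong (λ { (unp i) → refl ; (pr j) → refl })

split-at-unp : ∀ {n m} {i : Fin n} (w : Word n m) → i ∈ unprimed w → Σ (Word n m) λ p → Σ (Word n m) λ r → w ≡ p ++ unp i ∷ r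
split-at-unp (unp x ∷ w) (here refl) = [] , w , refl
split-at-unp (unp x ∷ w) (there i∈)  = let p , r , eq = split-at-unp w i∈ in unp x ∷ p , r , cong (unp x ∷_) eq
split-at-unp (pr j ∷ w)  i∈          = let p , r , eq = split-at-unp w i∈ in pr j ∷ p , r , cong (pr j ∷_) eq

unique-labels : ∀ {n m} (w : Word n m) → Unique (unprimed w) → Unique (primed w) → Unique w
unique-labels []          _        _        = []
unique-labels (unp i ∷ w) (i∉ ∷ u) v        = unp-∉ w i∉ ∷ unique-labels w u v
  where
  unp-∉ : ∀ w → All (i ≢_) (unprimed w) → All (unp i ≢_) w
  unp-∉ []           _          = []
  unp-∉ (unp i' ∷ w) (i≢i' ∷ a) = (λ { refl → i≢i' refl }) ∷ unp-∉ w a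
  unp-∉ (pr j ∷ w)   a          = (λ ()) ∷ unp-∉ w a
unique-labels (pr j ∷ w)  u        (j∉ ∷ v) = pr-∉ w j∉ ∷ unique-labels w u v
  where
  pr-∉ : ∀ w → All (j ≢_) (primed w) → All (pr j ≢_) w
  pr-∉ []           _          = []
  pr-∉ (unp i ∷ w)  a          = (λ ()) ∷ pr-∉ w a
  pr-∉ (pr j' ∷ w)  (j≢j' ∷ a) = (λ { refl → j≢j' refl }) ∷ pr-∉ w a

shuffle-unique : ∀ {n m} {w : Word n m} → IsShuffle w → Unique w
shuffle-unique {n} {m} {w} (un , pm) =
  unique-labels w (subst Unique (sym un) (UniqueP.allFin⁺ n)) (subst Unique (sym pm) (UniqueP.allFin⁺ m))

ν⁻¹L-injective : ∀ {n m} {a b : Label n m} → ν⁻¹L a ≡ ν⁻¹L b → a ≡ b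
ν⁻¹L-injective {a = unp i} {unp i'} eq = cong unp (cyc-injective (unp-injective eq))
  where unp-injective : ∀ {x y : Fin _} → _≡_ {A = Label _ _} (unp x) (unp y) → x ≡ y
        unp-injective refl = refl
ν⁻¹L-injective {a = pr j}  {pr j'}  refl = refl

-- ζ is a bijection from shuffles onto X

primedBefore-here : ∀ {n m} (i : Fin n) (w : Word n m) → primedBefore i (unp i ∷ w) ≡ 0
primedBefore-here i w rewrite dec-true (i FinP.≟ i) refl = refl

primedBefore-unp : ∀ {n m} {i i' : Fin n} (w : Word n m) → i ≢ i' →
                   primedBefore i (unp i' ∷ w) ≡ primedBefore i w
primedBefore-unp {i = i} {i'} w i≢i' rewrite dec-false (i FinP.≟ i') i≢i' = refl

primedBefore-absent : ∀ {n m} {i : Fin n} (w : Word n m) → i ∉ unprimed w →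
                      primedBefore i w ≡ length (primed w)
primedBefore-absent []           i∉ = refl
primedBefore-absent (unp i' ∷ w) i∉ = trans (primedBefore-unp w (i∉ ∘ here)) (primedBefore-absent w (i∉ ∘ there))
primedBefore-absent (pr j ∷ w)   i∉ = cong suc (primedBefore-absent w i∉)

primedBefore-++ˡ : ∀ {n m} {i : Fin n} (p r : Word n m) → i ∈ unprimed p →
                   primedBefore i (p ++ r) ≡ primedBefore i p
primedBefore-++ˡ {i = i} (unp i' ∷ p) r i∈ with i FinP.≟ i' | i∈
... | yes _    | _         = refl
... | no i≢i'  | here i≡i' = ⊥-elim (i≢i' i≡i')
... | no _     | there i∈p = primedBefore-++ˡ p r i∈p
primedBefore-++ˡ (pr j ∷ p) r i∈ = cong suc (primedBefore-++ˡ p r i∈)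

primedBefore-++ʳ : ∀ {n m} {i : Fin n} (p r : Word n m) → i ∉ unprimed p →
                   primedBefore i (p ++ r) ≡ length (primed p) ℕ.+ primedBefore i r
primedBefore-++ʳ []           r i∉ = refl
primedBefore-++ʳ (unp i' ∷ p) r i∉ = trans (primedBefore-unp (p ++ r) (i∉ ∘ here)) (primedBefore-++ʳ p r (i∉ ∘ there))
primedBefore-++ʳ (pr j ∷ p)   r i∉ = cong suc (primedBefore-++ʳ p r i∉)

primedBefore-relabel : ∀ {n n' m} {f : Fin n → Fin n'} → (∀ {i j} → f i ≡ f j → i ≡ j) →
                       ∀ i (w : Word n m) → primedBefore (f i) (List.map (relabel f) w) ≡ primedBefore i w
primedBefore-relabel         f-inj i []           = refl
primedBefore-relabel {f = f} f-inj i (unp i' ∷ w) with i FinP.≟ i'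
... | yes refl = primedBefore-here (f i) (List.map (relabel f) w)
... | no i≢i'  = trans (primedBefore-unp (List.map (relabel f) w) (i≢i' ∘ f-inj))
                       (primedBefore-relabel f-inj i w)
primedBefore-relabel         f-inj i (pr j ∷ w)   = cong suc (primedBefore-relabel f-inj i w)

primedBefore-≤ : ∀ {n m} (i : Fin n) (w : Word n m) → primedBefore i w ≤ length (primed w)
primedBefore-≤ i []           = z≤n
primedBefore-≤ i (unp i' ∷ w) with i FinP.≟ i'
... | yes _ = z≤n
... | no  _ = primedBefore-≤ i w
primedBefore-≤ i (pr j ∷ w)   = s≤s (primedBefore-≤ i w)

primedBefore-mono : ∀ {n m} {i i' : Fin n} (w : Word n m) → AllPairs Fin._<_ (unprimed w) →
                    i ∈ unprimed w → i Fin.≤ i' → primedBefore i w ≤ primedBefore i' w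
primedBefore-mono (pr j ∷ w) sorted i∈ i≤i' = s≤s (primedBefore-mono w sorted i∈ i≤i')
primedBefore-mono {i = i} {i'} (unp x ∷ w) (x< ∷ sorted) i∈ i≤i' with i FinP.≟ x | i∈
... | yes _    | _         = z≤n
... | no i≢x   | here i≡x  = ⊥-elim (i≢x i≡x)
... | no _     | there i∈w = subst (_ ≤_) (sym (primedBefore-unp w i'≢x)) (primedBefore-mono w sorted i∈w i≤i')
  where
  i'≢x : i' ≢ x
  i'≢x refl = ℕP.<⇒≱ (All.lookup x< i∈w) i≤i'

primedBefore-injective : ∀ {n m} (w w' : Word n m) → Unique (unprimed w) →
                         unprimed w ≡ unprimed w' → primed w ≡ primed w' →
                         (∀ i → primedBefore i w ≡ primedBefore i w') → w ≡ w'
primedBefore-injective []          []           _ _ _ _ = refl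
primedBefore-injective []          (pr j ∷ w')  _ _ () _
primedBefore-injective (pr j ∷ w)  []           _ _ () _
primedBefore-injective (unp i ∷ w) (pr j ∷ w')  _ _ _ h = ⊥-elim (ℕP.0≢1+n (trans (sym (primedBefore-here i w)) (h i)))
primedBefore-injective (pr j ∷ w)  (unp i ∷ w') _ _ _ h = ⊥-elim (ℕP.0≢1+n (trans (sym (primedBefore-here i w')) (sym (h i))))
primedBefore-injective (pr j ∷ w)  (pr j' ∷ w') u un pm h with refl , pm' ← ListP.∷-injective pm =
  cong (pr j ∷_) (primedBefore-injective w w' u un pm' (ℕP.suc-injective ∘ h))
primedBefore-injective (unp i ∷ w) (unp i' ∷ w') (i∉ ∷ u) un pm h with refl , un' ← ListP.∷-injective un =
  cong (unp i ∷_) (primedBefore-injective w w' u un' pm h')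
  where
  h' : ∀ k → primedBefore k w ≡ primedBefore k w'
  h' k with k FinP.≟ i
  ... | yes refl = trans (primedBefore-absent w (λ k∈ → All.lookup i∉ k∈ refl))
                     (trans (cong length pm)
                            (sym (primedBefore-absent w' (λ k∈ → All.lookup i∉ (subst (k ∈_) (sym un') k∈) refl))))
  ... | no k≢i = trans (sym (primedBefore-unp w k≢i)) (trans (h k) (primedBefore-unp w' k≢i))

lookup-ζ : ∀ {n m} (w : Word n m) (i : Fin n) → lookup (ζ w) (opposite i) ≡ primedBefore i w
lookup-ζ w i = trans (VecP.lookup∘tabulate _ (opposite i)) (cong (λ k → primedBefore k w) (FinP.opposite-involutive i))

ζ-injective : ∀ {n m} (w w' : Word n m) → IsShuffle w → IsShuffle w' → ζ w ≡ ζ w' → w ≡ w'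
ζ-injective {n} w w' (un , pm) (un' , pm') ζw≡ζw' =
  primedBefore-injective w w' (subst Unique (sym un) (UniqueP.allFin⁺ n)) (trans un (sym un')) (trans pm (sym pm'))
    (λ i → trans (sym (lookup-ζ w i)) (trans (cong (λ v → lookup v (opposite i)) ζw≡ζw') (lookup-ζ w' i)))

ζ-isX : ∀ {n m} (w : Word n m) → IsShuffle w → IsX m (ζ w)
ζ-isX {n} {m} w (un , pm) = bounded , decreasing
  where
  bounded : ∀ k → lookup (ζ w) k ≤ m
  bounded k = subst₂ _≤_ (sym (VecP.lookup∘tabulate _ k)) (trans (cong length pm) (length-allFin m))
                     (primedBefore-≤ (opposite k) w)
  decreasing : ∀ k l → k Fin.≤ l → lookup (ζ w) l ≤ lookup (ζ w) k
  decreasing k l k≤l = subst₂ _≤_ (sym (VecP.lookup∘tabulate _ l)) (sym (VecP.lookup∘tabulate _ k))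
    (primedBefore-mono w (subst (AllPairs Fin._<_) (sym un) (allFin-sorted n))
                         (subst (opposite l ∈_) (sym un) (∈-allFin (opposite l))) (opposite-anti k≤l))

-- The lattice path of a partition v with parts at most c: the last row, of
-- length x = head v, comes after the first x of the c primed letters.
wordOf : ∀ {k m} → Vec ℕ k → ℕ → Word k m
wordOf {m = m}     Vec.[]       c = List.map pr (List.take c (allFin m))
wordOf {suc k} {m} (x Vec.∷ v)  c =
  List.map (relabel inject₁) (wordOf v x) ++ unp (fromℕ k) ∷ List.map pr (List.drop x (List.take c (allFin m)))

IsX-tail : ∀ {k c x} {v : Vec ℕ k} → IsX c (x Vec.∷ v) → IsX x v
IsX-tail (_ , decreasing) =
  (λ i → decreasing Fin.zero (Fin.suc i) z≤n) , (λ i l i≤l → decreasing (Fin.suc i) (Fin.suc l) (s≤s i≤l))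

length-take-allFin : ∀ {m x} → x ≤ m → length (List.take x (allFin m)) ≡ x
length-take-allFin {m} {x} x≤m =
  trans (ListP.length-take x (allFin m)) (trans (cong (x ℕ.⊓_) (length-allFin m)) (ℕP.m≤n⇒m⊓n≡m x≤m))

unprimed-wordOf : ∀ {k m} (v : Vec ℕ k) c → unprimed (wordOf {m = m} v c) ≡ allFin k
unprimed-wordOf {m = m}     Vec.[]      c = unprimed-map-pr (List.take c (allFin m))
unprimed-wordOf {suc k} {m} (x Vec.∷ v) c = begin
  unprimed (U ++ unp (fromℕ k) ∷ R)        ≡⟨ unprimed-++ U (unp (fromℕ k) ∷ R) ⟩
  unprimed U ++ fromℕ k ∷ unprimed R       ≡⟨ cong₂ (λ a b → a ++ fromℕ k ∷ b) unprimed-U (unprimed-map-pr js) ⟩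
  List.map inject₁ (allFin k) ∷ʳ fromℕ k   ≡⟨ sym (allFin-∷ʳ k) ⟩
  allFin (suc k)                           ∎
  where
  open ≡-Reasoning
  js = List.drop x (List.take c (allFin m))
  U = List.map (relabel inject₁) (wordOf v x)
  R = List.map pr js
  unprimed-U : unprimed U ≡ List.map inject₁ (allFin k)
  unprimed-U = trans (unprimed-relabel inject₁ (wordOf v x)) (cong (List.map inject₁) (unprimed-wordOf v x))

primed-wordOf : ∀ {k m} (v : Vec ℕ k) c → IsX c v → primed (wordOf {m = m} v c) ≡ List.take c (allFin m)
primed-wordOf     Vec.[]      c _   = primed-map-pr _
primed-wordOf {m = m} (x Vec.∷ v) c isX = begin
  primed (List.map (relabel inject₁) (wordOf v x) ++ unp _ ∷ List.map pr (List.drop x (List.take c A)))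
    ≡⟨ primed-++ (List.map (relabel inject₁) (wordOf v x)) (unp _ ∷ List.map pr (List.drop x (List.take c A))) ⟩
  primed (List.map (relabel inject₁) (wordOf v x)) ++ primed (List.map pr (List.drop x (List.take c A)))
    ≡⟨ cong₂ _++_ (trans (primed-relabel inject₁ (wordOf v x)) (primed-wordOf v x (IsX-tail isX)))
                  (primed-map-pr (List.drop x (List.take c A))) ⟩
  List.take x A ++ List.drop x (List.take c A)
    ≡⟨ cong (_++ List.drop x (List.take c A)) (trans (cong (λ y → List.take y A) (sym (ℕP.m≤n⇒m⊓n≡m (proj₁ isX Fin.zero))))
                           (sym (ListP.take-take x c A))) ⟩
  List.take x (List.take c A) ++ List.drop x (List.take c A)
    ≡⟨ ListP.take++drop≡id x (List.take c A) ⟩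
  List.take c A ∎
  where open ≡-Reasoning
        A = allFin m

ζ-wordOf : ∀ {k m} (v : Vec ℕ k) c → c ≤ m → IsX c v → ζ (wordOf {m = m} v c) ≡ v
ζ-wordOf             Vec.[]      c c≤m isX = refl
ζ-wordOf {suc k} {m} (x Vec.∷ v) c c≤m isX = cong₂ Vec._∷_ first rest
  where
  x≤m = ℕP.≤-trans (proj₁ isX Fin.zero) c≤m
  U = List.map (relabel inject₁) (wordOf {m = m} v x)
  R = List.map pr (List.drop x (List.take c (allFin m)))
  unprimed-U : unprimed U ≡ List.map inject₁ (allFin k)
  unprimed-U = trans (unprimed-relabel inject₁ (wordOf v x)) (cong (List.map inject₁) (unprimed-wordOf v x))
  first : primedBefore (fromℕ k) (U ++ unp (fromℕ k) ∷ R) ≡ x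
  first = begin
    primedBefore (fromℕ k) (U ++ unp (fromℕ k) ∷ R)
      ≡⟨ primedBefore-++ʳ U _ (λ ∈U → let _ , _ , eq = ∈-map⁻ inject₁ (subst (fromℕ k ∈_) unprimed-U ∈U)
                                     in FinP.fromℕ≢inject₁ eq) ⟩
    length (primed U) ℕ.+ primedBefore (fromℕ k) (unp (fromℕ k) ∷ R)
      ≡⟨ cong₂ ℕ._+_ (cong length (trans (primed-relabel inject₁ (wordOf v x)) (primed-wordOf v x (IsX-tail isX))))
                     (primedBefore-here (fromℕ k) R) ⟩
    length (List.take x (allFin m)) ℕ.+ 0
      ≡⟨ trans (ℕP.+-identityʳ _) (length-take-allFin x≤m) ⟩
    x ∎
    where open ≡-Reasoning
  rest : tabulate (λ p → primedBefore (inject₁ (opposite p)) (U ++ unp (fromℕ k) ∷ R)) ≡ v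
  rest = trans (VecP.tabulate-cong (λ p →
                  trans (primedBefore-++ˡ U _ (subst (inject₁ (opposite p) ∈_) (sym unprimed-U)
                                                  (∈-map⁺ inject₁ (∈-allFin (opposite p)))))
                        (primedBefore-relabel FinP.inject₁-injective (opposite p) (wordOf v x))))
               (ζ-wordOf v x x≤m (IsX-tail isX))

wordOf-isShuffle : ∀ {k m} (v : Vec ℕ k) → IsX m v → IsShuffle (wordOf {m = m} v m)
wordOf-isShuffle {m = m} v isX =
  unprimed-wordOf v m ,
  trans (primed-wordOf v m isX) (ListP.take-all m (allFin m) (ℕP.≤-reflexive (length-allFin m)))

ζ-surjective : ∀ {n m} (lam : Vec ℕ n) → IsX m lam → Σ (Word n m) λ w → IsShuffle w × ζ w ≡ lam
ζ-surjective lam isX = wordOf lam _ , wordOf-isShuffle lam isX , ζ-wordOf lam _ ℕP.≤-refl isX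

-- Adjacent letters and corners

-- β = ε_a − ε_b is read as the pair of one-line entries a, b.
left right : ∀ {n m} → IsoRoot n m → Label n m
left  (pos i j) = unp i
left  (neg i j) = pr j
right (pos i j) = pr j
right (neg i j) = unp i

record Adjacent {n m} (β : IsoRoot n m) (w : Word n m) : Set where
  constructor adjacent
  field
    before after : Word n m
    split        : w ≡ before ++ left β ∷ right β ∷ after

swapAt : ∀ {n m} {β : IsoRoot n m} {w : Word n m} → Adjacent β w → Word n m
swapAt {β = β} (adjacent p q _) = p ++ right β ∷ left β ∷ q

swapAt-adjacent : ∀ {n m} {β : IsoRoot n m} {w} (d : Adjacent β w) → Adjacent (- β ᴵ) (swapAt d)
swapAt-adjacent {β = pos i j} (adjacent p q _) = adjacent p q refl
swapAt-adjacent {β = neg i j} (adjacent p q _) = adjacent p q refl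

swapAt-swapAt : ∀ {n m} {β : IsoRoot n m} {w} (d : Adjacent β w) → swapAt (swapAt-adjacent d) ≡ w
swapAt-swapAt {β = pos i j} (adjacent p q eq) = sym eq
swapAt-swapAt {β = neg i j} (adjacent p q eq) = sym eq

swapAt-isShuffle : ∀ {n m} {β : IsoRoot n m} {w} (d : Adjacent β w) → IsShuffle w → IsShuffle (swapAt d)
swapAt-isShuffle {β = β} (adjacent p q refl) (un , pm) =
  trans (unprimed-++ p (right β ∷ left β ∷ q))
        (trans (cong (unprimed p ++_) (unprimed-swap β)) (trans (sym (unprimed-++ p _)) un)) ,
  trans (primed-++ p (right β ∷ left β ∷ q))
        (trans (cong (primed p ++_) (primed-swap β)) (trans (sym (primed-++ p _)) pm))
  where
  unprimed-swap : ∀ β → unprimed (right β ∷ left β ∷ q) ≡ unprimed (left β ∷ right β ∷ q)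
  unprimed-swap (pos i j) = refl
  unprimed-swap (neg i j) = refl
  primed-swap : ∀ β → primed (right β ∷ left β ∷ q) ≡ primed (left β ∷ right β ∷ q)
  primed-swap (pos i j) = refl
  primed-swap (neg i j) = refl

swapAt-unique : ∀ {n m} {β : IsoRoot n m} {w} → Unique w → (d d' : Adjacent β w) → swapAt d ≡ swapAt d'
swapAt-unique {β = β} u (adjacent p q refl) (adjacent p' q' eq)
  with refl , q≡q' ← ++-∷-cancel p p' (Unique[xs++y∷ys]⇒y∉xs p u)
                                      (Unique[xs++y∷ys]⇒y∉xs p' (subst Unique eq u)) eq
  with refl ← ListP.∷-injectiveʳ q≡q' = refl

shuffle-unp-∉ : ∀ {n m} p {i : Fin n} q → IsShuffle {n} {m} (p ++ unp i ∷ q) → i ∉ unprimed p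
shuffle-unp-∉ {n} p {i} q (un , _) =
  Unique[xs++y∷ys]⇒y∉xs (unprimed p) (subst Unique (trans (sym un) (unprimed-++ p (unp i ∷ q))) (UniqueP.allFin⁺ n))

shuffle-unp-position : ∀ {n m} p {i : Fin n} q → IsShuffle {n} {m} (p ++ unp i ∷ q) → toℕ i ≡ length (unprimed p)
shuffle-unp-position p {i} q (un , _) = allFin-position (unprimed p) (trans (sym un) (unprimed-++ p (unp i ∷ q)))

shuffle-pr-position : ∀ {n m} p {j : Fin m} q → IsShuffle {n} {m} (p ++ pr j ∷ q) → toℕ j ≡ length (primed p)
shuffle-pr-position p {j} q (_ , pm) = allFin-position (primed p) (trans (sym pm) (primed-++ p (pr j ∷ q)))

shuffle-pr-after-unp : ∀ {n m} p {i : Fin n} {j : Fin m} q → IsShuffle (p ++ unp i ∷ pr j ∷ q) →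
                       toℕ j ≡ length (primed p)
shuffle-pr-after-unp p {i} {j} q sh =
  trans (shuffle-pr-position (p ++ unp i ∷ []) q (subst IsShuffle (sym (ListP.++-assoc p (unp i ∷ []) (pr j ∷ q))) sh))
        (cong length (primed-∷ʳ-unp p i))

primedBefore-split : ∀ {n m} p {i : Fin n} (r : Word n m) → i ∉ unprimed p →
                     primedBefore i (p ++ unp i ∷ r) ≡ length (primed p)
primedBefore-split p {i} r i∉ =
  trans (primedBefore-++ʳ p (unp i ∷ r) i∉) (trans (cong (_ ℕ.+_) (primedBefore-here i r)) (ℕP.+-identityʳ _))

primedBefore-swap-≢ : ∀ {n m} {i' i : Fin n} {j : Fin m} (p q : Word n m) → i' ≢ i →
                      primedBefore i' (p ++ pr j ∷ unp i ∷ q) ≡ primedBefore i' (p ++ unp i ∷ pr j ∷ q)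
primedBefore-swap-≢ {j = j} [] q i'≢i =
  trans (cong suc (primedBefore-unp q i'≢i)) (sym (primedBefore-unp (pr j ∷ q) i'≢i))
primedBefore-swap-≢ {i' = i'} (unp x ∷ p) q i'≢i with i' FinP.≟ x
... | yes _ = refl
... | no  _ = primedBefore-swap-≢ p q i'≢i
primedBefore-swap-≢ (pr _ ∷ p) q i'≢i = cong suc (primedBefore-swap-≢ p q i'≢i)

primedBefore-swap-self : ∀ {n m} {i : Fin n} {j : Fin m} (p q : Word n m) → i ∉ unprimed p →
                         primedBefore i (p ++ pr j ∷ unp i ∷ q) ≡ suc (primedBefore i (p ++ unp i ∷ pr j ∷ q))
primedBefore-swap-self {i = i} p q i∉ = begin
  primedBefore i (p ++ pr _ ∷ unp i ∷ q)          ≡⟨ primedBefore-++ʳ p _ i∉ ⟩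
  length (primed p) ℕ.+ suc (primedBefore i (unp i ∷ q))   ≡⟨ cong (λ x → length (primed p) ℕ.+ suc x) (primedBefore-here i q) ⟩
  length (primed p) ℕ.+ 1                         ≡⟨ ℕP.+-comm _ 1 ⟩
  suc (length (primed p))                         ≡⟨ cong suc (sym (primedBefore-split p (pr _ ∷ q) i∉)) ⟩
  suc (primedBefore i (p ++ unp i ∷ pr _ ∷ q))    ∎
  where open ≡-Reasoning

ζ-swap : ∀ {n m} (p q : Word n m) {i j} → i ∉ unprimed p →
         ζ (p ++ pr j ∷ unp i ∷ q) ≡ addBox i (ζ (p ++ unp i ∷ pr j ∷ q))
ζ-swap p q {i} {j} i∉ = trans (VecP.tabulate-cong row) (VecP.tabulate∘lookup _)
  where
  w = p ++ unp i ∷ pr j ∷ q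
  row : ∀ k → primedBefore (opposite k) (p ++ pr j ∷ unp i ∷ q) ≡ lookup (addBox i (ζ w)) k
  row k with k FinP.≟ opposite i
  ... | yes refl = trans (cong (λ x → primedBefore x (p ++ pr j ∷ unp i ∷ q)) (FinP.opposite-involutive i))
                     (trans (primedBefore-swap-self p q i∉)
                            (sym (trans (VecP.lookup∘updateAt (opposite i) (ζ w)) (cong suc (lookup-ζ w i)))))
  ... | no k≢    = trans (primedBefore-swap-≢ p q (λ { refl → k≢ (sym (FinP.opposite-involutive k)) }))
                     (sym (trans (VecP.lookup∘updateAt′ k (opposite i) k≢ (ζ w)) (VecP.lookup∘tabulate _ k)))

removeBox-addBox : ∀ {n} (i : Fin n) v → removeBox i (addBox i v) ≡ v
removeBox-addBox i v = trans (VecP.updateAt-updateAt (opposite i) v) (VecP.updateAt-id (opposite i) v)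

addBox-removeBox : ∀ {n} (i : Fin n) v {x} → lookup v (opposite i) ≡ suc x → addBox i (removeBox i v) ≡ v
addBox-removeBox i v eq = trans (VecP.updateAt-updateAt (opposite i) v)
  (VecP.updateAt-id-local (opposite i) v (trans (cong (λ z → suc (ℕ.pred z)) eq) (sym eq)))

t-corner : ∀ {n m} (β : IsoRoot n m) lam → IsX m lam → X_ β lam → IsX m (t_ β lam) × X_ (- β ᴵ) (t_ β lam)
t-corner {m = m} (pos i j) lam isX (at-j , isX⁺) =
  isX⁺ , trans (VecP.lookup∘updateAt (opposite i) lam) (cong suc at-j) , subst (IsX m) (sym (removeBox-addBox i lam)) isX
t-corner {m = m} (neg i j) lam isX (at-sj , isX⁻) =
  isX⁻ , trans (VecP.lookup∘updateAt (opposite i) lam) (cong ℕ.pred at-sj) ,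
  subst (IsX m) (sym (addBox-removeBox i lam at-sj)) isX

t-involutive : ∀ {n m} (β : IsoRoot n m) lam → X_ β lam → t_ (- β ᴵ) (t_ β lam) ≡ lam
t-involutive (pos i j) lam _           = removeBox-addBox i lam
t-involutive (neg i j) lam (at-sj , _) = addBox-removeBox i lam at-sj

adjacent⇒corner : ∀ {n m} (β : IsoRoot n m) {w} (d : Adjacent β w) → IsShuffle w →
                  X_ β (ζ w) × t_ β (ζ w) ≡ ζ (swapAt d)
adjacent⇒corner {m = m} (pos i j) (adjacent p q refl) sh =
  (lookup-at-i , subst (IsX m) ζ-swapped (ζ-isX (p ++ pr j ∷ unp i ∷ q) (swapAt-isShuffle (adjacent p q refl) sh))) ,
  sym ζ-swapped
  where
  i∉ = shuffle-unp-∉ p (pr j ∷ q) sh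
  ζ-swapped = ζ-swap p q i∉
  lookup-at-i : lookup (ζ (p ++ unp i ∷ pr j ∷ q)) (opposite i) ≡ toℕ j
  lookup-at-i = trans (lookup-ζ (p ++ unp i ∷ pr j ∷ q) i) (trans (primedBefore-split p (pr j ∷ q) i∉)
                  (sym (shuffle-pr-after-unp p q sh)))
adjacent⇒corner {m = m} (neg i j) d@(adjacent p q refl) sh =
  (lookup-at-i , subst (IsX m) (sym removed) (ζ-isX (p ++ unp i ∷ pr j ∷ q) sh')) , removed
  where
  sh' = swapAt-isShuffle d sh
  pos-corner = adjacent⇒corner (pos i j) (swapAt-adjacent d) sh'
  removed : removeBox i (ζ (p ++ pr j ∷ unp i ∷ q)) ≡ ζ (p ++ unp i ∷ pr j ∷ q)
  removed = trans (cong (removeBox i) (sym (proj₂ pos-corner))) (removeBox-addBox i _)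
  lookup-at-i : lookup (ζ (p ++ pr j ∷ unp i ∷ q)) (opposite i) ≡ suc (toℕ j)
  lookup-at-i = trans (cong (λ v → lookup v (opposite i)) (sym (proj₂ pos-corner)))
                  (trans (VecP.lookup∘updateAt (opposite i) (ζ (p ++ unp i ∷ pr j ∷ q)))
                         (cong suc (proj₁ (proj₁ pos-corner))))

-- Rows i and i + 1 have the same length when i is immediately followed by i + 1.
¬outerCorner-before-unp : ∀ {n m} p {i i' : Fin n} q → IsShuffle {n} {m} (p ++ unp i ∷ unp i' ∷ q) →
                          ¬ IsX m (addBox i (ζ (p ++ unp i ∷ unp i' ∷ q)))
¬outerCorner-before-unp p {i} {i'} q sh (_ , decreasing) =
  ℕP.1+n≰n (subst₂ _≤_ at-i at-i' (decreasing _ _ (opposite-anti i≤i')))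
  where
  v = p ++ unp i ∷ unp i' ∷ q
  sh' : IsShuffle ((p ++ unp i ∷ []) ++ unp i' ∷ q)
  sh' = subst IsShuffle (sym (ListP.++-assoc p (unp i ∷ []) (unp i' ∷ q))) sh
  i'-position : toℕ i' ≡ suc (toℕ i)
  i'-position = begin
    toℕ i'                                 ≡⟨ shuffle-unp-position (p ++ unp i ∷ []) q sh' ⟩
    length (unprimed (p ++ unp i ∷ []))    ≡⟨ cong length (unprimed-++ p (unp i ∷ [])) ⟩
    length (unprimed p ++ i ∷ [])          ≡⟨ ListP.length-++ (unprimed p) ⟩
    length (unprimed p) ℕ.+ 1              ≡⟨ ℕP.+-comm _ 1 ⟩
    suc (length (unprimed p))              ≡⟨ cong suc (sym (shuffle-unp-position p (unp i' ∷ q) sh)) ⟩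
    suc (toℕ i)                            ∎
    where open ≡-Reasoning
  i≤i' : i Fin.≤ i'
  i≤i' = ℕP.≤-trans (ℕP.n≤1+n (toℕ i)) (ℕP.≤-reflexive (sym i'-position))
  i'≢i : opposite i' ≢ opposite i
  i'≢i eq = ℕP.1+n≢n (trans (sym i'-position) (cong toℕ (opposite-injective eq)))
  at-i : lookup (addBox i (ζ v)) (opposite i) ≡ suc (length (primed p))
  at-i = trans (VecP.lookup∘updateAt (opposite i) (ζ v))
               (cong suc (trans (lookup-ζ v i) (primedBefore-split p (unp i' ∷ q) (shuffle-unp-∉ p (unp i' ∷ q) sh))))
  at-i' : lookup (addBox i (ζ v)) (opposite i') ≡ length (primed p)
  at-i' = trans (VecP.lookup∘updateAt′ (opposite i') (opposite i) i'≢i (ζ v))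
    (trans (lookup-ζ v i')
      (trans (cong (primedBefore i') (sym (ListP.++-assoc p (unp i ∷ []) (unp i' ∷ q))))
        (trans (primedBefore-split (p ++ unp i ∷ []) q (shuffle-unp-∉ (p ++ unp i ∷ []) q sh'))
               (cong length (primed-∷ʳ-unp p i)))))

outerCorner⇒adjacent : ∀ {n m} {i : Fin n} {j : Fin m} (w : Word n m) → IsShuffle w →
                       OuterCorner m i j (ζ w) → Adjacent (pos i j) w
outerCorner⇒adjacent {m = m} {i} {j} w sh (at-j , isX⁺)
  with p , r , refl ← split-at-unp w (subst (i ∈_) (sym (proj₁ sh)) (∈-allFin i)) =
  next r sh (trans (sym (primedBefore-split p r (shuffle-unp-∉ p r sh))) (trans (sym (lookup-ζ (p ++ unp i ∷ r) i)) at-j))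
         isX⁺
  where
  next : ∀ r → IsShuffle (p ++ unp i ∷ r) → length (primed p) ≡ toℕ j →
         IsX m (addBox i (ζ (p ++ unp i ∷ r))) → Adjacent (pos i j) (p ++ unp i ∷ r)
  next []           (_ , pm) p≡j _ =
    ⊥-elim (ℕP.<-irrefl (trans (sym p≡j) (trans (cong length (trans (sym (primed-∷ʳ-unp p i)) pm)) (length-allFin m)))
                        (FinP.toℕ<n j))
  next (pr j' ∷ q)  sh       p≡j _
    with refl ← FinP.toℕ-injective (trans (shuffle-pr-after-unp p q sh) p≡j) = adjacent p q refl
  next (unp i' ∷ q) sh       _   isX⁺ = ⊥-elim (¬outerCorner-before-unp p q sh isX⁺)

innerCorner⇒adjacent : ∀ {n m} {i : Fin n} {j : Fin m} (w : Word n m) → IsShuffle w →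
                       InnerCorner m i j (ζ w) → Adjacent (neg i j) w
innerCorner⇒adjacent {m = m} {i} {j} w sh (at-sj , isX⁻) =
  adjacent (Adjacent.before d) (Adjacent.after d) (sym swapped≡w)
  where
  -- the partition with the corner removed has the outer corner i j' instead
  surj = ζ-surjective (removeBox i (ζ w)) isX⁻
  w' = proj₁ surj
  sh' = proj₁ (proj₂ surj)
  ζw' = proj₂ (proj₂ surj)
  d : Adjacent (pos i j) w'
  d = outerCorner⇒adjacent w' sh' (subst (OuterCorner m i j) (sym ζw')
        (trans (VecP.lookup∘updateAt (opposite i) (ζ w)) (cong ℕ.pred at-sj) ,
         subst (IsX m) (sym (addBox-removeBox i (ζ w) at-sj)) (ζ-isX w sh)))
  swapped≡w : swapAt d ≡ w
  swapped≡w = ζ-injective (swapAt d) w (swapAt-isShuffle d sh')  sh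
    (trans (sym (proj₂ (adjacent⇒corner (pos i j) d sh'))) (trans (cong (addBox i) ζw') (addBox-removeBox i (ζ w) at-sj)))

corner⇒adjacent : ∀ {n m} (β : IsoRoot n m) (w : Word n m) → IsShuffle w → X_ β (ζ w) → Adjacent β w
corner⇒adjacent (pos i j) = outerCorner⇒adjacent
corner⇒adjacent (neg i j) = innerCorner⇒adjacent

-- Simple roots and odd reflections

δ : ∀ {N} → Fin N → Fin N → ℤ
δ z a = if does (z FinP.≟ a) then ℤ.1ℤ else ℤ.0ℤ

δ-refl : ∀ {N} (a : Fin N) → δ a a ≡ ℤ.1ℤ
δ-refl a rewrite dec-true (a FinP.≟ a) refl = refl

δ-≢ : ∀ {N} {z a : Fin N} → z ≢ a → δ z a ≡ ℤ.0ℤ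
δ-≢ {z = z} {a} z≢a rewrite dec-false (z FinP.≟ a) z≢a = refl

lookup-rootV : ∀ {N} (a b z : Fin N) → lookup (rootV a b) z ≡ δ z a ℤ.+ ℤ.- δ z b
lookup-rootV a b z = trans (VecP.lookup-zipWith ℤ._+_ z (εv a) (⊖ εv b))
  (cong₂ ℤ._+_ (VecP.lookup∘tabulate _ z) (trans (VecP.lookup-map z ℤ.-_ (εv b)) (cong ℤ.-_ (VecP.lookup∘tabulate _ z))))

lookup-⊕ : ∀ {N} (u v : Vec ℤ N) z → lookup (u ⊕ v) z ≡ lookup u z ℤ.+ lookup v z
lookup-⊕ u v z = VecP.lookup-zipWith ℤ._+_ z u v

lookup-rootV≡1 : ∀ {N} (c d z : Fin N) → lookup (rootV c d) z ≡ ℤ.1ℤ → z ≡ c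
lookup-rootV≡1 c d z eq with z FinP.≟ c | z FinP.≟ d | lookup-rootV c d z
... | yes z≡c | _     | _ = z≡c
... | no  _   | yes _ | e with () ← trans (sym e) eq
... | no  _   | no  _ | e with () ← trans (sym e) eq

lookup-rootV≡-1 : ∀ {N} (c d z : Fin N) → lookup (rootV c d) z ≡ ℤ.-1ℤ → z ≡ d
lookup-rootV≡-1 c d z eq with z FinP.≟ c | z FinP.≟ d | lookup-rootV c d z
... | _     | yes z≡d | _ = z≡d
... | yes _ | no  _   | e with () ← trans (sym e) eq
... | no  _ | no  _   | e with () ← trans (sym e) eq

rootV-injective : ∀ {N} {a b c d : Fin N} → a ≢ b → rootV a b ≡ rootV c d → a ≡ c × b ≡ d
rootV-injective {a = a} {b} {c} {d} a≢b eq =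
  lookup-rootV≡1 c d a (trans (cong (λ v → lookup v a) (sym eq)) at-a) ,
  lookup-rootV≡-1 c d b (trans (cong (λ v → lookup v b) (sym eq)) at-b)
  where
  at-a : lookup (rootV a b) a ≡ ℤ.1ℤ
  at-a rewrite lookup-rootV a b a | δ-refl a | δ-≢ a≢b = refl
  at-b : lookup (rootV a b) b ≡ ℤ.-1ℤ
  at-b rewrite lookup-rootV a b b | δ-refl b | δ-≢ (a≢b ∘ sym) = refl

⊖-rootV : ∀ {N} (a b : Fin N) → ⊖ rootV a b ≡ rootV b a
⊖-rootV a b = vec-ext λ z → begin
  lookup (⊖ rootV a b) z          ≡⟨ VecP.lookup-map z ℤ.-_ (rootV a b) ⟩
  ℤ.- lookup (rootV a b) z        ≡⟨ cong ℤ.-_ (lookup-rootV a b z) ⟩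
  ℤ.- (δ z a ℤ.+ ℤ.- δ z b)       ≡⟨ negate (δ z a) (δ z b) ⟩
  δ z b ℤ.+ ℤ.- δ z a             ≡⟨ sym (lookup-rootV b a z) ⟩
  lookup (rootV b a) z            ∎
  where
  open ≡-Reasoning
  negate : ∀ x y → ℤ.- (x ℤ.+ ℤ.- y) ≡ y ℤ.+ ℤ.- x
  negate = solve-∀

rootV-⊕ : ∀ {N} (a b c : Fin N) → rootV b c ⊕ rootV a b ≡ rootV a c
rootV-⊕ a b c = vec-ext λ z → begin
  lookup (rootV b c ⊕ rootV a b) z                          ≡⟨ lookup-⊕ (rootV b c) (rootV a b) z ⟩
  lookup (rootV b c) z ℤ.+ lookup (rootV a b) z             ≡⟨ cong₂ ℤ._+_ (lookup-rootV b c z) (lookup-rootV a b z) ⟩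
  (δ z b ℤ.+ ℤ.- δ z c) ℤ.+ (δ z a ℤ.+ ℤ.- δ z b)           ≡⟨ telescope (δ z a) (δ z b) (δ z c) ⟩
  δ z a ℤ.+ ℤ.- δ z c                                       ≡⟨ sym (lookup-rootV a c z) ⟩
  lookup (rootV a c) z                                      ∎
  where
  open ≡-Reasoning
  telescope : ∀ x y w → (y ℤ.+ ℤ.- w) ℤ.+ (x ℤ.+ ℤ.- y) ≡ x ℤ.+ ℤ.- w
  telescope = solve-∀

rootV-⊕ʳ : ∀ {N} (a b c : Fin N) → rootV a b ⊕ rootV b c ≡ rootV a c
rootV-⊕ʳ a b c = trans (vec-ext λ z → trans (lookup-⊕ (rootV a b) (rootV b c) z)
                                       (trans (ℤP.+-comm (lookup (rootV a b) z) (lookup (rootV b c) z))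
                                              (sym (lookup-⊕ (rootV b c) (rootV a b) z))))
                       (rootV-⊕ a b c)

-- The sum has the coefficient 1 at both x and a.
rootV-⊕-disjoint : ∀ {N} {x y a b : Fin N} → x ≢ y → a ≢ b → x ≢ a → x ≢ b → y ≢ a → y ≢ b →
                   ¬ IsRoot (rootV x y ⊕ rootV a b)
rootV-⊕-disjoint {x = x} {y} {a} {b} x≢y a≢b x≢a x≢b y≢a y≢b (c , d , _ , eq) =
  x≢a (trans (at-one x at-x) (sym (at-one a at-a)))
  where
  at-one : ∀ z → lookup (rootV x y ⊕ rootV a b) z ≡ ℤ.1ℤ → z ≡ c
  at-one z one = lookup-rootV≡1 c d z (trans (cong (λ v → lookup v z) (sym eq)) one)
  at-x : lookup (rootV x y ⊕ rootV a b) x ≡ ℤ.1ℤ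
  at-x rewrite lookup-⊕ (rootV x y) (rootV a b) x | lookup-rootV x y x | lookup-rootV a b x
             | δ-refl x | δ-≢ x≢y | δ-≢ x≢a | δ-≢ x≢b = refl
  at-a : lookup (rootV x y ⊕ rootV a b) a ≡ ℤ.1ℤ
  at-a rewrite lookup-⊕ (rootV x y) (rootV a b) a | lookup-rootV x y a | lookup-rootV a b a
             | δ-refl a | δ-≢ (x≢a ∘ sym) | δ-≢ (y≢a ∘ sym) | δ-≢ a≢b = refl

rβ-self : ∀ {n m} (γ : Vec ℤ (n ℕ.+ m)) → rβ {n} {m} ⟨ γ ⟩ ⟨ γ ⟩ ≡ ⟨ ⊖ γ ⟩
rβ-self γ rewrite dec-true (VecP.≡-dec ℤ._≟_ γ γ) refl = refl

rβ-root : ∀ {n m} (γ β : Vec ℤ (n ℕ.+ m)) → β ≢ γ → IsRoot (β ⊕ γ) → rβ {n} {m} ⟨ γ ⟩ ⟨ β ⟩ ≡ ⟨ β ⊕ γ ⟩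
rβ-root γ β β≢γ root rewrite dec-false (VecP.≡-dec ℤ._≟_ β γ) β≢γ | dec-true (isRoot? (β ⊕ γ)) root = refl

rβ-fix : ∀ {n m} (γ β : Vec ℤ (n ℕ.+ m)) → β ≢ γ → ¬ IsRoot (β ⊕ γ) → rβ {n} {m} ⟨ γ ⟩ ⟨ β ⟩ ≡ ⟨ β ⟩
rβ-fix γ β β≢γ ¬root rewrite dec-false (VecP.≡-dec ℤ._≟_ β γ) β≢γ | dec-false (isRoot? (β ⊕ γ)) ¬root = refl

idx-injective : ∀ {n m} {a b : Label n m} → idx a ≡ idx b → a ≡ b
idx-injective {n} {m} {unp i} {unp i'} eq = cong unp (FinP.↑ˡ-injective m i i' eq)
idx-injective {n} {m} {pr j}  {pr j'}  eq = cong pr (FinP.↑ʳ-injective n j j' eq)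
idx-injective {n} {m} {unp i} {pr j}   eq = ⊥-elim (ℕP.<⇒≱
  (subst (ℕ._< n) (sym (FinP.toℕ-↑ˡ i m)) (FinP.toℕ<n i))
  (subst (n ℕ.≤_) (trans (sym (FinP.toℕ-↑ʳ n j)) (cong toℕ (sym eq))) (ℕP.m≤m+n n (toℕ j))))
idx-injective {n} {m} {pr j}  {unp i}  eq = sym (idx-injective (sym eq))

root : ∀ {n m} → Label n m → Label n m → Weight n m
root a b = ⟨ rootV (idx a) (idx b) ⟩

wt-root : ∀ {n m} (β : IsoRoot n m) → wt β ≡ root (left β) (right β)
wt-root (pos i j) = refl
wt-root (neg i j) = refl

∈-𝔟⁻ : ∀ {n m} {γ : Weight n m} (w : Word n m) → γ ∈ 𝔟 w →
       Σ (Word n m) λ p → Σ (Label n m) λ x → Σ (Label n m) λ y → Σ (Word n m) λ q →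
         w ≡ p ++ x ∷ y ∷ q × γ ≡ root x y
∈-𝔟⁻ (x ∷ y ∷ w) (here γ≡) = [] , x , y , w , refl , γ≡
∈-𝔟⁻ (x ∷ y ∷ w) (there γ∈) =
  let p , x' , y' , q , eq , γ≡ = ∈-𝔟⁻ (y ∷ w) γ∈ in x ∷ p , x' , y' , q , cong (x ∷_) eq , γ≡

∈-𝔟⁺ : ∀ {n m} (p : Word n m) x y q → root x y ∈ 𝔟 (p ++ x ∷ y ∷ q)
∈-𝔟⁺ []          x y q = here refl
∈-𝔟⁺ (z ∷ [])    x y q = there (here refl)
∈-𝔟⁺ (z ∷ z' ∷ p) x y q = there (∈-𝔟⁺ (z' ∷ p) x y q)

module _ {n m : ℕ} {a b : Label n m} (a≢b : a ≢ b) where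

  private
    γ = rootV (idx a) (idx b)
    idx≢ : ∀ {x y : Label n m} → x ≢ y → idx x ≢ idx y
    idx≢ x≢y = x≢y ∘ idx-injective

  reflect-disjoint : ∀ w → All (a ≢_) w → All (b ≢_) w → Unique w → r_ ⟨ γ ⟩ (𝔟 w) ≡ 𝔟 w
  reflect-disjoint []          _                 _                 _                = refl
  reflect-disjoint (x ∷ [])    _                 _                 _                = refl
  reflect-disjoint (x ∷ y ∷ w) (a≢x ∷ a≢y ∷ a∉) (b≢x ∷ b≢y ∷ b∉) ((x≢y ∷ _) ∷ u) =
    cong₂ _∷_ (rβ-fix γ _ (idx≢ (a≢x ∘ sym) ∘ proj₁ ∘ rootV-injective (idx≢ x≢y))
                 (rootV-⊕-disjoint (idx≢ x≢y) (idx≢ a≢b) (idx≢ (a≢x ∘ sym)) (idx≢ (b≢x ∘ sym))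
                                   (idx≢ (a≢y ∘ sym)) (idx≢ (b≢y ∘ sym))))
              (reflect-disjoint (y ∷ w) (a≢y ∷ a∉) (b≢y ∷ b∉) u)

  reflect-after : ∀ q → All (a ≢_) q → All (b ≢_) q → Unique q → r_ ⟨ γ ⟩ (𝔟 (b ∷ q)) ≡ 𝔟 (a ∷ q)
  reflect-after []      _           _           _ = refl
  reflect-after (c ∷ q) (a≢c ∷ a∉) (b≢c ∷ b∉) u =
    cong₂ _∷_ (trans (rβ-root γ _ (idx≢ a≢b ∘ sym ∘ proj₁ ∘ rootV-injective (idx≢ b≢c))
                          (idx a , idx c , idx≢ a≢c , rootV-⊕ (idx a) (idx b) (idx c)))
                     (cong ⟨_⟩ (rootV-⊕ (idx a) (idx b) (idx c))))
              (reflect-disjoint (c ∷ q) (a≢c ∷ a∉) (b≢c ∷ b∉) u)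

  reflect-𝔟 : ∀ p q → Unique (p ++ a ∷ b ∷ q) → r_ ⟨ γ ⟩ (𝔟 (p ++ a ∷ b ∷ q)) ≡ 𝔟 (p ++ b ∷ a ∷ q)
  reflect-𝔟 [] q ((_ ∷ a∉) ∷ b∉ ∷ u) =
    cong₂ _∷_ (trans (rβ-self γ) (cong ⟨_⟩ (⊖-rootV (idx a) (idx b)))) (reflect-after q a∉ b∉ u)
  reflect-𝔟 (x ∷ []) q ((x≢a ∷ x≢b ∷ _) ∷ u) =
    cong₂ _∷_ (trans (rβ-root γ _ (idx≢ x≢a ∘ proj₁ ∘ rootV-injective (idx≢ x≢a))
                          (idx x , idx b , idx≢ x≢b , rootV-⊕ʳ (idx x) (idx a) (idx b)))
                     (cong ⟨_⟩ (rootV-⊕ʳ (idx x) (idx a) (idx b))))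
              (reflect-𝔟 [] q u)
  reflect-𝔟 (x ∷ y ∷ p) q ((x≢y ∷ x∉) ∷ y∉ ∷ u) =
    cong₂ _∷_ (rβ-fix γ _ (idx≢ x≢a ∘ proj₁ ∘ rootV-injective (idx≢ x≢y))
                 (rootV-⊕-disjoint (idx≢ x≢y) (idx≢ a≢b) (idx≢ x≢a) (idx≢ x≢b) (idx≢ y≢a) (idx≢ y≢b)))
              (reflect-𝔟 (y ∷ p) q (y∉ ∷ u))
    where
    x≢a = All.lookup x∉ (∈-++⁺ʳ p (here refl))
    x≢b = All.lookup x∉ (∈-++⁺ʳ p (there (here refl)))
    y≢a = All.lookup y∉ (∈-++⁺ʳ p (here refl))
    y≢b = All.lookup y∉ (∈-++⁺ʳ p (there (here refl)))

left≢right : ∀ {n m} (β : IsoRoot n m) → left β ≢ right β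
left≢right (pos i j) ()
left≢right (neg i j) ()

simpleRoot⇒adjacent : ∀ {n m} (β : IsoRoot n m) (w : Word n m) → wt β ∈ 𝔟 w → Adjacent β w
simpleRoot⇒adjacent β w wt∈
  with p , x , y , q , refl , wt≡ ← ∈-𝔟⁻ w wt∈
  with x≡ , y≡ ← rootV-injective (left≢right β ∘ idx-injective) (cong vec (trans (sym (wt-root β)) wt≡)) =
  adjacent p q (cong₂ (λ x y → p ++ x ∷ y ∷ q) (sym (idx-injective x≡)) (sym (idx-injective y≡)))

adjacent⇒simpleRoot : ∀ {n m} (β : IsoRoot n m) {w} (d : Adjacent β w) → IsShuffle w →
                      wt β ∈ 𝔟 w × r_ (wt β) (𝔟 w) ≡ 𝔟 (swapAt d)
adjacent⇒simpleRoot β (adjacent p q refl) sh =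
  subst (_∈ 𝔟 (p ++ left β ∷ right β ∷ q)) (sym (wt-root β)) (∈-𝔟⁺ p (left β) (right β) q) ,
  trans (cong (λ γ → r_ γ (𝔟 (p ++ left β ∷ right β ∷ q))) (wt-root β))
        (reflect-𝔟 (left≢right β) p q (shuffle-unique sh))

𝔟-injective-∷ : ∀ {n m} (x : Label n m) r r' → Unique (x ∷ r) → 𝔟 (x ∷ r) ≡ 𝔟 (x ∷ r') → r ≡ r'
𝔟-injective-∷ x []      []        _                 _  = refl
𝔟-injective-∷ x []      (_ ∷ _)   _                 ()
𝔟-injective-∷ x (_ ∷ _) []        _                 ()
𝔟-injective-∷ x (y ∷ r) (y' ∷ r') ((x≢y ∷ _) ∷ u) eq
  with refl ← idx-injective {a = y} {y'} (proj₂ (rootV-injective (x≢y ∘ idx-injective) (cong vec (ListP.∷-injectiveˡ eq)))) =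
  cong (y ∷_) (𝔟-injective-∷ y r r' u (ListP.∷-injectiveʳ eq))

𝔟-injective : ∀ {n m} → 0 < n → 0 < m → (w w' : Word n m) → IsShuffle w → IsShuffle w' → 𝔟 w ≡ 𝔟 w' → w ≡ w'
𝔟-injective {n} {m} 0<n 0<m w w' sh sh' eq = go w w' (two≤ w sh) (two≤ w' sh') (shuffle-unique sh) eq
  where
  two≤ : ∀ v → IsShuffle v → 2 ≤ length v
  two≤ v (un , pm) = subst (2 ≤_)
    (sym (trans (length-unprimed+primed v) (cong₂ ℕ._+_ (trans (cong length un) (length-allFin n))
                                                       (trans (cong length pm) (length-allFin m)))))
    (ℕP.+-mono-≤ 0<n 0<m)
  go : ∀ v v' → 2 ≤ length v → 2 ≤ length v' → Unique v → 𝔟 v ≡ 𝔟 v' → v ≡ v'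
  go (x ∷ y ∷ r) (x' ∷ y' ∷ r') _ _ u@((x≢y ∷ _) ∷ _) eq
    with refl ← idx-injective {a = x} {x'} (proj₁ (rootV-injective (x≢y ∘ idx-injective) (cong vec (ListP.∷-injectiveˡ eq)))) =
    cong (x ∷_) (𝔟-injective-∷ x (y ∷ r) (y' ∷ r') u eq)
  go (_ ∷ [])    _             (s≤s ()) _        _ _
  go (_ ∷ _ ∷ _) (_ ∷ [])      _        (s≤s ()) _ _

-- The step σ ↦ σ̄

bar : ∀ {n m} → Word (suc n) m → Word (suc n) m
bar u = unp Fin.zero ∷ List.map ν⁻¹L u

data WordStep {n m : ℕ} : Word (suc n) m × ℤ → Word (suc n) m × ℤ → Set where
  wordStep : ∀ u k → IsShuffle (u ∷ʳ unp (fromℕ n)) →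
             WordStep (u ∷ʳ unp (fromℕ n) , k) (bar u , k ℤ.+ ℤ.1ℤ)

module _ {n m : ℕ} (u : Word (suc n) m) (sh : IsShuffle (u ∷ʳ unp (fromℕ n))) where

  unprimed-init : unprimed u ≡ List.map inject₁ (allFin n)
  unprimed-init = ListP.∷ʳ-injectiveˡ (unprimed u) _
    (trans (sym (unprimed-++ u (unp (fromℕ n) ∷ []))) (trans (proj₁ sh) (allFin-∷ʳ n)))

  primed-init : primed u ≡ allFin m
  primed-init = trans (sym (trans (primed-++ u (unp (fromℕ n) ∷ [])) (ListP.++-identityʳ _))) (proj₂ sh)

  bar-isShuffle : IsShuffle (bar u)
  bar-isShuffle =
    cong (Fin.zero ∷_) unprimed-tail , trans (cong primed (map-ν⁻¹L u)) (trans (primed-relabel cyc u) primed-init)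
    where
    unprimed-tail : unprimed (List.map ν⁻¹L u) ≡ List.tabulate Fin.suc
    unprimed-tail = begin
      unprimed (List.map ν⁻¹L u)                         ≡⟨ cong unprimed (map-ν⁻¹L u) ⟩
      unprimed (List.map (relabel cyc) u)                ≡⟨ unprimed-relabel cyc u ⟩
      List.map cyc (unprimed u)                          ≡⟨ cong (List.map cyc) unprimed-init ⟩
      List.map cyc (List.map inject₁ (allFin n))         ≡⟨ sym (ListP.map-∘ (allFin n)) ⟩
      List.map (cyc ∘ inject₁) (allFin n)                ≡⟨ ListP.map-cong cyc-inject₁ (allFin n) ⟩
      List.map Fin.suc (allFin n)                        ≡⟨ ListP.map-tabulate id Fin.suc ⟩
      List.tabulate Fin.suc                              ∎
      where open ≡-Reasoning

  fromℕ∉init : fromℕ n ∉ unprimed u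
  fromℕ∉init ∈u = let _ , _ , eq = ∈-map⁻ inject₁ (subst (fromℕ n ∈_) unprimed-init ∈u) in FinP.fromℕ≢inject₁ eq

  ζ-∷ʳ-last : ζ (u ∷ʳ unp (fromℕ n)) ≡ m Vec.∷ Vec.tail (ζ (u ∷ʳ unp (fromℕ n)))
  ζ-∷ʳ-last = cong (Vec._∷ Vec.tail (ζ (u ∷ʳ unp (fromℕ n))))
    (trans (primedBefore-split u [] fromℕ∉init) (trans (cong length primed-init) (length-allFin m)))

  ζ-bar : ζ (bar u) ≡ Vec.tail (ζ (u ∷ʳ unp (fromℕ n))) Vec.∷ʳ 0
  ζ-bar = sym (trans (cong₂ Vec._∷ʳ_ (VecP.tabulate-cong shifted) top)
                     (vec-tabulate-∷ʳ (λ k → primedBefore (opposite k) (bar u))))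
    where
    shifted : ∀ p → primedBefore (inject₁ (opposite p)) (u ∷ʳ unp (fromℕ n)) ≡ primedBefore (opposite (inject₁ p)) (bar u)
    shifted p = begin
      primedBefore i (u ∷ʳ unp (fromℕ n))
        ≡⟨ primedBefore-++ˡ u _ (subst (i ∈_) (sym unprimed-init) (∈-map⁺ inject₁ (∈-allFin (opposite p)))) ⟩
      primedBefore i u
        ≡⟨ sym (primedBefore-relabel cyc-injective i u) ⟩
      primedBefore (cyc i) (List.map (relabel cyc) u)
        ≡⟨ cong (primedBefore (cyc i)) (sym (map-ν⁻¹L u)) ⟩
      primedBefore (cyc i) (List.map ν⁻¹L u)
        ≡⟨ sym (primedBefore-unp (List.map ν⁻¹L u) (λ eq → FinP.0≢1+n (trans (sym eq) (cyc-inject₁ (opposite p))))) ⟩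
      primedBefore (cyc i) (bar u)
        ≡⟨ cong (λ k → primedBefore k (bar u)) (trans (cyc-inject₁ (opposite p)) (sym (opposite-inject₁ p))) ⟩
      primedBefore (opposite (inject₁ p)) (bar u) ∎
      where open ≡-Reasoning
            i = inject₁ (opposite p)
    top : 0 ≡ primedBefore (opposite (fromℕ n)) (bar u)
    top = sym (trans (cong (λ k → primedBefore k (bar u)) (opposite-fromℕ n)) (primedBefore-here Fin.zero (List.map ν⁻¹L u)))

wordOf-last : ∀ {n m} (xs : Vec ℕ n) →
              wordOf {m = m} (m Vec.∷ xs) m ≡ List.map (relabel inject₁) (wordOf xs m) ∷ʳ unp (fromℕ n)
wordOf-last {n} {m} xs = cong (λ js → List.map (relabel inject₁) (wordOf xs m) ++ unp (fromℕ n) ∷ List.map pr js)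
  (ListP.drop-all m (List.take m (allFin m)) (ℕP.≤-reflexive (length-take-allFin ℕP.≤-refl)))

wordStep-of-XStep : ∀ {n m} (xs : Vec ℕ n) → IsX m (m Vec.∷ xs) →
                    Σ (Word (suc n) m) λ u → IsShuffle (u ∷ʳ unp (fromℕ n)) ×
                      ζ (u ∷ʳ unp (fromℕ n)) ≡ m Vec.∷ xs × ζ (bar u) ≡ xs Vec.∷ʳ 0
wordStep-of-XStep {n} {m} xs isX =
  u , sh , ζ≡ , trans (ζ-bar u sh) (cong (λ v → Vec.tail v Vec.∷ʳ 0) ζ≡)
  where
  u = List.map (relabel inject₁) (wordOf xs m)
  sh = subst IsShuffle (wordOf-last xs) (wordOf-isShuffle (m Vec.∷ xs) isX)
  ζ≡ = trans (cong ζ (sym (wordOf-last xs))) (ζ-wordOf (m Vec.∷ xs) m ℕP.≤-refl isX)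

WordStep⇒XStep : ∀ {n m} {x y : Word (suc n) m × ℤ} → WordStep x y →
                 XStep m (suc n) (ζ (proj₁ x) , proj₂ x) (ζ (proj₁ y) , proj₂ y)
WordStep⇒XStep {n} {m} (wordStep u k sh) =
  subst₂ (λ a b → XStep m (suc n) (a , k) (b , k ℤ.+ ℤ.1ℤ)) (sym (ζ-∷ʳ-last u sh)) (sym (ζ-bar u sh))
    (xstep _ k (subst (IsX m) (ζ-∷ʳ-last u sh) (ζ-isX (u ∷ʳ unp (fromℕ n)) sh)))

WordStep⇒BStep : ∀ {n m} {x y : Word (suc n) m × ℤ} → WordStep x y →
                 BStep m (suc n) (𝔟 (proj₁ x) , proj₂ x) (𝔟 (proj₁ y) , proj₂ y)
WordStep⇒BStep (wordStep u k sh) = bstep u k sh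

right-ν : ∀ {n m} (β : IsoRoot n m) → right (ν β) ≡ ν⁻¹L (right β)
right-ν (pos i j) = refl
right-ν (neg i j) = refl

adjacent-∷ʳ⁺ : ∀ {n m} {β : IsoRoot n m} {u} y → Adjacent β u → Adjacent β (u ∷ʳ y)
adjacent-∷ʳ⁺ {β = β} y (adjacent p q refl) = adjacent p (q ∷ʳ y) (ListP.++-assoc p (left β ∷ right β ∷ q) (y ∷ []))

swapAt-∷ʳ⁺ : ∀ {n m} {β : IsoRoot n m} {u} y (d : Adjacent β u) → swapAt (adjacent-∷ʳ⁺ y d) ≡ swapAt d ∷ʳ y
swapAt-∷ʳ⁺ {β = β} y (adjacent p q refl) = sym (ListP.++-assoc p (right β ∷ left β ∷ q) (y ∷ []))

adjacent-∷ʳ : ∀ {n m} {β : IsoRoot n m} {u y} → Adjacent β (u ∷ʳ y) →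
              Adjacent β u ⊎ (right β ≡ y × Σ (Word n m) λ p → u ≡ p ∷ʳ left β)
adjacent-∷ʳ {β = β} {u} {y} (adjacent p q eq) with List.initLast q
... | []       with u≡ , r≡ ← ListP.∷ʳ-injective u (p ∷ʳ left β)
                                 (trans eq (sym (ListP.++-assoc p (left β ∷ []) (right β ∷ [])))) =
  inj₂ (sym r≡ , p , u≡)
... | q ∷ʳ′ z  with u≡ , _ ← ListP.∷ʳ-injective u (p ++ left β ∷ right β ∷ q)
                                 (trans eq (sym (ListP.++-assoc p (left β ∷ right β ∷ q) (z ∷ [])))) =
  inj₁ (adjacent p q u≡)

bar-adjacent : ∀ {n m} {β : IsoRoot (suc n) m} {u} → Adjacent β u → Adjacent (ν β) (bar u)
bar-adjacent {β = pos i j} (adjacent p q refl) =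
  adjacent (unp Fin.zero ∷ List.map ν⁻¹L p) (List.map ν⁻¹L q) (cong (unp Fin.zero ∷_) (ListP.map-++ ν⁻¹L p _))
bar-adjacent {β = neg i j} (adjacent p q refl) =
  adjacent (unp Fin.zero ∷ List.map ν⁻¹L p) (List.map ν⁻¹L q) (cong (unp Fin.zero ∷_) (ListP.map-++ ν⁻¹L p _))

swapAt-bar : ∀ {n m} {β : IsoRoot (suc n) m} {u} (d : Adjacent β u) → swapAt (bar-adjacent d) ≡ bar (swapAt d)
swapAt-bar {β = pos i j} (adjacent p q refl) = cong (unp Fin.zero ∷_) (sym (ListP.map-++ ν⁻¹L p _))
swapAt-bar {β = neg i j} (adjacent p q refl) = cong (unp Fin.zero ∷_) (sym (ListP.map-++ ν⁻¹L p _))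

adjacent-right∈tail : ∀ {n m} {β : IsoRoot n m} {a w} → Adjacent β (a ∷ w) → right β ∈ w
adjacent-right∈tail (adjacent []      q refl) = here refl
adjacent-right∈tail (adjacent (x ∷ p) q refl) = ∈-++⁺ʳ p (there (here refl))

module _ {n m : ℕ} where

  ζ× : Word (suc n) m × ℤ → Vec ℕ (suc n) × ℤ
  ζ× x = ζ (proj₁ x) , proj₂ x

  𝔟× : Word (suc n) m × ℤ → Borel (suc n) m × ℤ
  𝔟× x = 𝔟 (proj₁ x) , proj₂ x

  ShuffleAt : Word (suc n) m × ℤ → Set
  ShuffleAt x = IsShuffle (proj₁ x)

  _∼W_ : Word (suc n) m × ℤ → Word (suc n) m × ℤ → Set
  _∼W_ = EqClosure WordStep

  ∼W⇒∼X : ∀ {x y} → x ∼W y → ζ× x ∼X[ m ] ζ× y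
  ∼W⇒∼X = Equivalence.gmap ζ× WordStep⇒XStep

  ∼W⇒∼B : ∀ {x y} → x ∼W y → 𝔟× x ∼B 𝔟× y
  ∼W⇒∼B = Equivalence.gmap 𝔟× WordStep⇒BStep

  ∼X⇒∼W : ∀ {x y} → ShuffleAt x → ShuffleAt y → ζ× x ∼X[ m ] ζ× y → x ∼W y
  ∼X⇒∼W = Lift.lift ζ× ShuffleAt WordStep (XStep m (suc n)) injective lift-fwd lift-bwd
    where
    injective : ∀ {x y} → ShuffleAt x → ShuffleAt y → ζ× x ≡ ζ× y → x ≡ y
    injective {w , k} {w' , k'} sh sh' eq with ζ≡ , refl ← ,-injective eq =
      cong (_, k) (ζ-injective w w' sh sh' ζ≡)
    lift-fwd : ∀ {b b' x} → XStep m (suc n) b b' → ShuffleAt x → ζ× x ≡ b →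
               Σ _ λ y → ShuffleAt y × WordStep x y × ζ× y ≡ b'
    lift-fwd {x = v , _} (xstep xs k isX) sh eq
      with u , shu , ζu , ζbar ← wordStep-of-XStep xs isX
      with ζv , refl ← ,-injective eq
      with refl ← ζ-injective v (u ∷ʳ unp (fromℕ n)) sh shu (trans ζv (sym ζu)) =
      (bar u , k ℤ.+ ℤ.1ℤ) , bar-isShuffle u shu , wordStep u k shu , cong (_, _) ζbar
    lift-bwd : ∀ {b b' x} → XStep m (suc n) b b' → ShuffleAt x → ζ× x ≡ b' →
               Σ _ λ y → ShuffleAt y × WordStep y x × ζ× y ≡ b
    lift-bwd {x = v , _} (xstep xs k isX) sh eq
      with u , shu , ζu , ζbar ← wordStep-of-XStep xs isX
      with ζv , refl ← ,-injective eq
      with refl ← ζ-injective v (bar u) sh (bar-isShuffle u shu) (trans ζv (sym ζbar)) =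
      (u ∷ʳ unp (fromℕ n) , k) , shu , wordStep u k shu , cong (_, k) ζu

  ∼B⇒∼W : 0 < m → ∀ {x y} → ShuffleAt x → ShuffleAt y → 𝔟× x ∼B 𝔟× y → x ∼W y
  ∼B⇒∼W 0<m = Lift.lift 𝔟× ShuffleAt WordStep (BStep m (suc n)) injective lift-fwd lift-bwd
    where
    injective : ∀ {x y} → ShuffleAt x → ShuffleAt y → 𝔟× x ≡ 𝔟× y → x ≡ y
    injective {w , k} {w' , k'} sh sh' eq with 𝔟≡ , refl ← ,-injective eq =
      cong (_, k) (𝔟-injective (s≤s z≤n) 0<m w w' sh sh' 𝔟≡)
    lift-fwd : ∀ {b b' x} → BStep m (suc n) b b' → ShuffleAt x → 𝔟× x ≡ b →
               Σ _ λ y → ShuffleAt y × WordStep x y × 𝔟× y ≡ b'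
    lift-fwd {x = v , _} (bstep u k shu) sh eq
      with 𝔟v , refl ← ,-injective eq
      with refl ← 𝔟-injective (s≤s z≤n) 0<m v _ sh shu 𝔟v =
      (bar u , k ℤ.+ ℤ.1ℤ) , bar-isShuffle u shu , wordStep u k shu , refl
    lift-bwd : ∀ {b b' x} → BStep m (suc n) b b' → ShuffleAt x → 𝔟× x ≡ b' →
               Σ _ λ y → ShuffleAt y × WordStep y x × 𝔟× y ≡ b
    lift-bwd {x = v , _} (bstep u k shu) sh eq
      with 𝔟v , refl ← ,-injective eq
      with refl ← 𝔟-injective (s≤s z≤n) 0<m v (bar u) sh (bar-isShuffle u shu) 𝔟v =
      (u ∷ʳ unp (fromℕ n) , k) , shu , wordStep u k shu , refl

module _ {n m : ℕ} (α : IsoRoot (suc n) m) where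

  AdjacentAt : Word (suc n) m × ℤ → Set
  AdjacentAt (w , k) = IsShuffle w × Adjacent (ν^ k α) w

  swapAt× : ∀ x → AdjacentAt x → Word (suc n) m × ℤ
  swapAt× (w , k) (_ , d) = swapAt d , k

  private
    last : Label (suc n) m
    last = unp (fromℕ n)

    functional : ∀ {x y x' y' : Word (suc n) m × ℤ} → WordStep x y → WordStep x' y' → x ≡ x' → y ≡ y'
    functional (wordStep u k _) (wordStep u' k' _) eq
      with eqw , refl ← ,-injective eq
      with refl ← ListP.∷ʳ-injectiveˡ u u' eqw = refl

    injective : ∀ {x y x' y' : Word (suc n) m × ℤ} → WordStep x y → WordStep x' y' → y ≡ y' → x ≡ x'
    injective (wordStep u k _) (wordStep u' k' _) eq
      with eqw , eqk ← ,-injective eq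
      with refl ← ListP.map-injective ν⁻¹L-injective (ListP.∷-injectiveʳ eqw)
      with refl ← +1-injective {k} {k'} eqk = refl

    irrelevant : ∀ {x} (p p' : AdjacentAt x) → swapAt× x p ≡ swapAt× x p'
    irrelevant (sh , d) (_ , d') = cong (_, _) (swapAt-unique (shuffle-unique sh) d d')

    -- If the pair of ν^k α ended with the last letter n of u ∷ʳ n, then bar u
    -- would end with a primed letter and admit no further step.
    propagate : ∀ {x z z' y} → AdjacentAt x → WordStep x z → WordStep z' y → z ≡ z' → AdjacentAt z
    propagate (_ , d) (wordStep u k shu) (wordStep u' k' _) eq with adjacent-∷ʳ d
    ... | inj₁ du = bar-isShuffle u shu , subst (λ β → Adjacent β (bar u)) (sym (ν^-suc k α)) (bar-adjacent du)
    ... | inj₂ (right≡ , p , refl) = ⊥-elim (both-unprimed (ν^ k α) right≡ last≡)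
      where
      last≡ : ν⁻¹L (left (ν^ k α)) ≡ last
      last≡ = ListP.∷ʳ-injectiveʳ (unp Fin.zero ∷ List.map ν⁻¹L p) u'
        (trans (cong (unp Fin.zero ∷_) (sym (ListP.map-++ ν⁻¹L p (left (ν^ k α) ∷ [])))) (,-injectiveˡ eq))
      both-unprimed : ∀ β → right β ≡ last → ν⁻¹L (left β) ≡ last → ⊥
      both-unprimed (pos i j) () _
      both-unprimed (neg i j) _ ()

    commute : ∀ {x z} (px : AdjacentAt x) (pz : AdjacentAt z) → WordStep x z →
              WordStep (swapAt× x px) (swapAt× z pz)
    commute (sh , d) (sh' , d') (wordStep u k shu) with ν^ (k ℤ.+ ℤ.1ℤ) α | ν^-suc k α | adjacent-∷ʳ d
    ... | _ | refl | inj₁ du =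
      subst₂ WordStep (cong (_, k) (sym swapped)) (cong (_, _) (sym swapped-bar))
        (wordStep (swapAt du) k (subst IsShuffle (swapAt-∷ʳ⁺ last du) (swapAt-isShuffle (adjacent-∷ʳ⁺ last du) shu)))
      where
      swapped : swapAt d ≡ swapAt du ∷ʳ last
      swapped = trans (swapAt-unique (shuffle-unique sh) d (adjacent-∷ʳ⁺ last du)) (swapAt-∷ʳ⁺ last du)
      swapped-bar : swapAt d' ≡ bar (swapAt du)
      swapped-bar = trans (swapAt-unique (shuffle-unique sh') d' (bar-adjacent du)) (swapAt-bar du)
    -- otherwise the pair of ν^(k+1) α would end with the first letter 1 of bar u
    ... | _ | refl | inj₂ (right≡ , _) =
      ⊥-elim (UniqueP.Unique[x∷xs]⇒x∉xs (shuffle-unique sh') (subst (_∈ _) right-ν≡ (adjacent-right∈tail d')))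
      where
      right-ν≡ : right (ν (ν^ k α)) ≡ unp Fin.zero
      right-ν≡ = trans (right-ν (ν^ k α)) (trans (cong ν⁻¹L right≡) (cong unp (cyc-fromℕ n)))

  word-transport : ∀ {x y} (px : AdjacentAt x) (py : AdjacentAt y) → x ∼W y → swapAt× x px ∼W swapAt× y py
  word-transport = Chain.Transport.transport WordStep functional injective AdjacentAt swapAt× irrelevant propagate commute

ζ-swapAt : ∀ {n m} {β : IsoRoot n m} {w} (d : Adjacent β w) → IsShuffle w → ζ (swapAt d) ≡ t_ β (ζ w)
ζ-swapAt d sh = sym (proj₂ (adjacent⇒corner _ d sh))

r-swapAt : ∀ {n m} {β : IsoRoot n m} {w} (d : Adjacent β w) → IsShuffle w → r_ (wt β) (𝔟 w) ≡ 𝔟 (swapAt d)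
r-swapAt d sh = proj₂ (adjacent⇒simpleRoot _ d sh)

partA : ∀ n m → 0 < n → (α : IsoRoot n m) → PartA n m α
partA (suc n) m _ α = lands , well-defined , inverse
  where
  lands : ∀ lam j → IsX m lam → X_ (ν^ j α) lam → IsX m (t_ (ν^ j α) lam) × X_ (ν^ j (- α ᴵ)) (t_ (ν^ j α) lam)
  lands lam j isX cx = subst (λ β → IsX m (t_ (ν^ j α) lam) × X_ β (t_ (ν^ j α) lam)) (sym (ν^-neg j α))
                             (t-corner (ν^ j α) lam isX cx)
  well-defined : ∀ lam lam' j j' → IsX m lam → IsX m lam' → X_ (ν^ j α) lam → X_ (ν^ j' α) lam' →
                 (lam , j) ∼X[ m ] (lam' , j') → (t_ (ν^ j α) lam , j) ∼X[ m ] (t_ (ν^ j' α) lam' , j')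
  well-defined lam lam' j j' isX isX' cx cx' path
    with v , sh , refl ← ζ-surjective lam isX
    with v' , sh' , refl ← ζ-surjective lam' isX' =
    subst₂ (λ a b → (a , j) ∼X[ m ] (b , j')) (ζ-swapAt d sh) (ζ-swapAt d' sh')
      (∼W⇒∼X (word-transport α (sh , d) (sh' , d') (∼X⇒∼W sh sh' path)))
    where
    d = corner⇒adjacent (ν^ j α) v sh cx
    d' = corner⇒adjacent (ν^ j' α) v' sh' cx'
  inverse : ∀ lam j → IsX m lam → X_ (ν^ j α) lam → (t_ (ν^ j (- α ᴵ)) (t_ (ν^ j α) lam) , j) ∼X[ m ] (lam , j)
  inverse lam j _ cx = subst (λ z → (z , j) ∼X[ m ] (lam , j))
    (sym (trans (cong (λ β → t_ β (t_ (ν^ j α) lam)) (ν^-neg j α)) (t-involutive (ν^ j α) lam cx))) ε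

partB : ∀ n m → 0 < n → n < m → (α : IsoRoot n m) → PartB n m α
partB (suc n) m _ n<m α = lands , well-defined , inverse
  where
  lands : ∀ b j → InB° b → wt (ν^ j α) ∈ b → InB° (r_ (wt (ν^ j α)) b) × (wt (ν^ j (- α ᴵ)) ∈ r_ (wt (ν^ j α)) b)
  lands _ j (w , sh , refl) wt∈ =
    (swapAt d , swapAt-isShuffle d sh , sym (r-swapAt d sh)) ,
    subst₂ (λ β b → wt β ∈ b) (sym (ν^-neg j α)) (sym (r-swapAt d sh))
      (proj₁ (adjacent⇒simpleRoot _ (swapAt-adjacent d) (swapAt-isShuffle d sh)))
    where d = simpleRoot⇒adjacent (ν^ j α) w wt∈
  well-defined : ∀ b b' j j' → InB° b → InB° b' → wt (ν^ j α) ∈ b → wt (ν^ j' α) ∈ b' → (b , j) ∼B (b' , j') →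
                 (r_ (wt (ν^ j α)) b , j) ∼B (r_ (wt (ν^ j' α)) b' , j')
  well-defined _ _ j j' (w , sh , refl) (w' , sh' , refl) wt∈ wt∈' path =
    subst₂ (λ a b → (a , j) ∼B (b , j')) (sym (r-swapAt d sh)) (sym (r-swapAt d' sh'))
      (∼W⇒∼B (word-transport α (sh , d) (sh' , d') (∼B⇒∼W (ℕP.<-trans (s≤s z≤n) n<m) sh sh' path)))
    where
    d = simpleRoot⇒adjacent (ν^ j α) w wt∈
    d' = simpleRoot⇒adjacent (ν^ j' α) w' wt∈'
  inverse : ∀ b j → InB° b → wt (ν^ j α) ∈ b → (r_ (wt (ν^ j (- α ᴵ))) (r_ (wt (ν^ j α)) b) , j) ∼B (b , j)
  inverse _ j (w , sh , refl) wt∈ = subst (λ b → (b , j) ∼B (𝔟 w , j)) (sym back) ε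
    where
    d = simpleRoot⇒adjacent (ν^ j α) w wt∈
    back : r_ (wt (ν^ j (- α ᴵ))) (r_ (wt (ν^ j α)) (𝔟 w)) ≡ 𝔟 w
    back = begin
      r_ (wt (ν^ j (- α ᴵ))) (r_ (wt (ν^ j α)) (𝔟 w))   ≡⟨ cong₂ (λ β b → r_ (wt β) b) (ν^-neg j α) (r-swapAt d sh) ⟩
      r_ (wt (- ν^ j α ᴵ)) (𝔟 (swapAt d))              ≡⟨ r-swapAt (swapAt-adjacent d) (swapAt-isShuffle d sh) ⟩
      𝔟 (swapAt (swapAt-adjacent d))                   ≡⟨ cong 𝔟 (swapAt-swapAt d) ⟩
      𝔟 w                                              ∎
      where open ≡-Reasoning

InY⇒InZ : ∀ {n m} (α : IsoRoot (suc n) m) w k → IsShuffle w → InY α (ζ w , k) → InZ α (𝔟 w , k)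
InY⇒InZ α w k sh (lam , j , isX , cx , path) with v , shv , refl ← ζ-surjective lam isX =
  𝔟 v , j , (v , shv , refl) , proj₁ (adjacent⇒simpleRoot _ (corner⇒adjacent (ν^ j α) v shv cx) shv) ,
  ∼W⇒∼B (∼X⇒∼W shv sh path)

InZ⇒InY : ∀ {n m} → 0 < m → (α : IsoRoot (suc n) m) → ∀ w k → IsShuffle w → InZ α (𝔟 w , k) → InY α (ζ w , k)
InZ⇒InY 0<m α w k sh (_ , j , (v , shv , refl) , wt∈ , path) =
  ζ v , j , ζ-isX v shv , proj₁ (adjacent⇒corner _ (simpleRoot⇒adjacent (ν^ j α) v wt∈) shv) ,
  ∼W⇒∼X (∼B⇒∼W 0<m shv sh path)

intertwine : ∀ {n m} (α : IsoRoot (suc n) m) w w' j → IsShuffle w → IsShuffle w' →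
             X_ (ν^ j α) (ζ w) → ζ w' ≡ t_ (ν^ j α) (ζ w) →
             Σ (Borel (suc n) m) λ b → Σ ℤ λ j' → InB° b × (wt (ν^ j' α) ∈ b) × ((b , j') ∼B (𝔟 w , j)) ×
               ((r_ (wt (ν^ j' α)) b , j') ∼B (𝔟 w' , j))
intertwine α w w' j sh sh' cx ζw' =
  𝔟 w , j , (w , sh , refl) , proj₁ (adjacent⇒simpleRoot _ d sh) , ε ,
  subst (λ b → (b , j) ∼B (𝔟 w' , j)) (sym (trans (r-swapAt d sh) (cong 𝔟 swapped≡w'))) ε
  where
  d = corner⇒adjacent (ν^ j α) w sh cx
  swapped≡w' : swapAt d ≡ w'
  swapped≡w' = ζ-injective (swapAt d) w' (swapAt-isShuffle d sh) sh' (trans (ζ-swapAt d sh) (sym ζw'))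

partC : ∀ n m → 0 < n → n < m → PartC n m
partC (suc n) m _ n<m =
  ζ-surjective ,
  (λ w w' k k' sh sh' → ∼W⇒∼B ∘ ∼X⇒∼W sh sh') ,
  (λ w w' k k' sh sh' → ∼W⇒∼X ∘ ∼B⇒∼W 0<m sh sh') ,
  (λ { _ k (w , sh , refl) → w , sh , ε }) ,
  (λ α w k sh → mk⇔ (InY⇒InZ α w k sh) (InZ⇒InY 0<m α w k sh)) ,
  intertwine
  where 0<m = ℕP.<-trans (s≤s z≤n) n<m

corollary3p7 : (n m : ℕ) → 0 < n → n < m →
    ((α : IsoRoot n m) → PartA n m α) ×
    ((α : IsoRoot n m) → PartB n m α) ×
    PartC n m
corollary3p7 n m 0<n n<m = partA n m 0<n , partB n m 0<n n<m , partC n m 0<n n<m
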